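{- Let $\mathbf t=(t_1,t_2,t_3)$ be non-negative integers, $k=t_1+t_2+t_3+2$, and $n>w$. Consider the first partitioning step of Generalized Yaroslavskiy Quicksort (context) on an input $U_1,\dots,U_n$ i.i.d. uniform on $(0,1)$, and let $T_S$ be the number of swaps performed by Yaroslavskiy's partitioning procedure in this step. Let $\mathbf I=(I_1,I_2,I_3)$ be the numbers of small, medium and large ordinary elements. Then $T_S=I_1+(l@\mathcal K)$ and, conditional on $\mathbf I$, $$T_S\overset{\mathcal D}{=}I_1+\mathrm{HypG}(I_1+I_2,I_3,n-k)+\mathrm B\!\left(\tfrac{I_3}{n-k}\right).$$
   Context: Setting: sample of $k$ elements (the $t_1+t_2+1$ leftmost and $t_3+1$ rightmost positions), sorted; pivots $P$ = the $(t_1+1)$-st smallest and $Q$ = the $(t_1+t_2+2)$-nd smallest sample element. The other $n-k$ elements (ordinary elements, occupying the contiguous range between the two parts of the sample, at their initial positions) are partitioned by Yaroslavskiy's method with $p=P$, $q=Q$ on that range [left..right]: $\ell\gets$left; $g\gets$right; $k\gets\ell$; while $k\le g$: { if $A[k]<p$: swap $A[k],A[\ell]$; $\ell\gets\ell+1$; else if $A[k]\ge q$: { while $A[g]>q$ and $k<g$: $g\gets g-1$; if $A[g]\ge p$: swap $A[k],A[g]$; else: swap $A[k],A[g]$, swap $A[k],A[\ell]$, $\ell\gets\ell+1$; $g\gets g-1$ }; $k\gets k+1$ }. Each "swap" counts as one swap. An element is small if $<P$, medium if between $P$ and $Q$, large if $>Q$. $w$ is the Insertionsort threshold (a constant $\ge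 k$). $\mathcal K$ is the set of all index values attained by the index $k$ during this partitioning step; $l@\mathcal K$ is the number of positions $i\in\mathcal K$ whose initial entry $U_i$ is large. $\mathrm{HypG}(m,r,N)$ denotes the number of red balls obtained when drawing $m$ times without replacement from an urn of $N$ balls of which $r$ are red; $\mathrm B(p)$ is a Bernoulli variable equal to $1$ with probability $p$. -}

module Defs where

open import Data.Bool using (Bool; true; false; if_then_else_; _∧_)
open import Data.Nat using (ℕ; zero; suc; _+_; _∸_; _<ᵇ_; _≤ᵇ_; _≡ᵇ_)
open import Data.List using (List; []; _∷_; _++_; length; filter; map; concatMap; take; drop; upTo; reverse)

count : {A : Set} → (A → Bool) → List A → ℕ
count p []       = 0
count p (x ∷ xs) = if p x then suc (count p xs) else count p xs

-- 0-based lookup with default 0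
nth : List ℕ → ℕ → ℕ
nth []       _       = 0
nth (x ∷ xs) zero    = x
nth (x ∷ xs) (suc i) = nth xs i

insert : ℕ → List ℕ → List ℕ
insert x []       = x ∷ []
insert x (y ∷ ys) = if x ≤ᵇ y then x ∷ y ∷ ys else y ∷ insert x ys

sort : List ℕ → List ℕ
sort []       = []
sort (x ∷ xs) = insert x (sort xs)

insertAll : {A : Set} → A → List A → List (List A)
insertAll x []       = (x ∷ []) ∷ []
insertAll x (y ∷ ys) = (x ∷ y ∷ ys) ∷ map (y ∷_) (insertAll x ys)

perms : {A : Set} → List A → List (List A)
perms []       = [] ∷ []
perms (x ∷ xs) = concatMap (insertAll x) (perms xs)

bools : ℕ → List (List Bool)
bools zero    = [] ∷ []
bools (suc N) = map (true ∷_) (bools N) ++ map (false ∷_) (bools N)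

reds : List Bool → ℕ
reds = count (λ b → b)

-- Generalized Yaroslavskiy Quicksort, first partitioning step.
-- Array positions are 1-based: position i holds (nth U (i ∸ 1)).

kOf : ℕ → ℕ → ℕ → ℕ
kOf t1 t2 t3 = t1 + t2 + t3 + 2

array : List ℕ → ℕ → ℕ
array U i = nth U (i ∸ 1)

sample : ℕ → ℕ → ℕ → List ℕ → List ℕ
sample t1 t2 t3 U = take (t1 + t2 + 1) U ++ drop (length U ∸ (t3 + 1)) U

-- P = (t1+1)-st smallest, Q = (t1+t2+2)-nd smallest sample element
pivotP : ℕ → ℕ → ℕ → List ℕ → ℕ
pivotP t1 t2 t3 U = nth (sort (sample t1 t2 t3 U)) t1

pivotQ : ℕ → ℕ → ℕ → List ℕ → ℕ
pivotQ t1 t2 t3 U = nth (sort (sample t1 t2 t3 U)) (t1 + t2 + 1)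

-- range [left..right] of ordinary elements
leftOf : ℕ → ℕ → ℕ → List ℕ → ℕ
leftOf t1 t2 t3 U = t1 + t2 + 2

rightOf : ℕ → ℕ → ℕ → List ℕ → ℕ
rightOf t1 t2 t3 U = length U ∸ (t3 + 1)

ordinary : ℕ → ℕ → ℕ → List ℕ → List ℕ
ordinary t1 t2 t3 U = take (length U ∸ kOf t1 t2 t3) (drop (t1 + t2 + 1) U)

swapA : (ℕ → ℕ) → ℕ → ℕ → (ℕ → ℕ)
swapA A i j x = if x ≡ᵇ i then A j else if x ≡ᵇ j then A i else A x

-- inner loop: while A[g] > q and k < g: g ← g − 1
innerG : (ℕ → ℕ) → ℕ → ℕ → ℕ → ℕ
innerG A q k zero    = zero
innerG A q k (suc g) =
  if (q <ᵇ A (suc g)) ∧ (k <ᵇ suc g) then innerG A q k g else suc g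

record State : Set where
  constructor st
  field
    arr     : ℕ → ℕ
    ℓ g k   : ℕ
    swaps   : ℕ
    visited : List ℕ   -- values of k at which the loop body was executed

step : ℕ → ℕ → State → State
step p q (st A ℓ g k sw vis) =
  if A k <ᵇ p
  then st (swapA A k ℓ) (suc ℓ) g (suc k) (suc sw) (k ∷ vis)
  else if q ≤ᵇ A k
  then (let g′ = innerG A q k g in
        if p ≤ᵇ A g′
        then st (swapA A k g′) ℓ (g′ ∸ 1) (suc k) (suc sw) (k ∷ vis)
        else st (swapA (swapA A k g′) k ℓ) (suc ℓ) (g′ ∸ 1) (suc k) (2 + sw) (k ∷ vis))
  else st A ℓ g (suc k) sw (k ∷ vis)

-- the loop, with fuel (fuel length U + 1 suffices: k increases and
-- g never increases in every iteration)
loop : ℕ → ℕ → ℕ → State → State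
loop zero    p q s = s
loop (suc f) p q s =
  if State.k s ≤ᵇ State.g s then loop f p q (step p q s) else s

partitionRun : ℕ → ℕ → ℕ → List ℕ → State
partitionRun t1 t2 t3 U =
  loop (suc (length U)) (pivotP t1 t2 t3 U) (pivotQ t1 t2 t3 U)
       (st (array U) (leftOf t1 t2 t3 U) (rightOf t1 t2 t3 U) (leftOf t1 t2 t3 U) 0 [])

TS : ℕ → ℕ → ℕ → List ℕ → ℕ
TS t1 t2 t3 U = State.swaps (partitionRun t1 t2 t3 U)

I₁ : ℕ → ℕ → ℕ → List ℕ → ℕ
I₁ t1 t2 t3 U = count (λ x → x <ᵇ pivotP t1 t2 t3 U) (ordinary t1 t2 t3 U)

I₂ : ℕ → ℕ → ℕ → List ℕ → ℕ
I₂ t1 t2 t3 U = count (λ x → (pivotP t1 t2 t3 U <ᵇ x) ∧ (x <ᵇ pivotQ t1 t2 t3 U)) (ordinary t1 t2 t3 U)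

I₃ : ℕ → ℕ → ℕ → List ℕ → ℕ
I₃ t1 t2 t3 U = count (λ x → pivotQ t1 t2 t3 U <ᵇ x) (ordinary t1 t2 t3 U)

-- 𝒦 : index values of k (during the loop); large𝒦 : those whose initial entry is large
𝒦 : ℕ → ℕ → ℕ → List ℕ → List ℕ
𝒦 t1 t2 t3 U = reverse (State.visited (partitionRun t1 t2 t3 U))

large𝒦 : ℕ → ℕ → ℕ → List ℕ → ℕ
large𝒦 t1 t2 t3 U = count (λ i → pivotQ t1 t2 t3 U <ᵇ array U i) (𝒦 t1 t2 t3 U)

-- Urn model for HypG(m, r, N) + B(r/N):
-- a uniformly random colour sequence c of the N balls (r red = true),
-- HypG = reds among the first m draws, B = the (m+1)-st draw is red.
hypGplusB : ℕ → List Bool → ℕ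
hypGplusB m c = reds (take m c) + reds (take 1 (drop m c))

hasI : ℕ → ℕ → ℕ → ℕ → ℕ → ℕ → List ℕ → Bool
hasI t1 t2 t3 i1 i2 i3 U =
  (I₁ t1 t2 t3 U ≡ᵇ i1) ∧ (I₂ t1 t2 t3 U ≡ᵇ i2) ∧ (I₃ t1 t2 t3 U ≡ᵇ i3)

module Submission where

-- Part 1, T_S = I₁ + l@𝒦, is a loop-invariant analysis of Yaroslavskiy's
-- partitioning run on an arbitrary array with pivots p ≤ q, no entry equal
-- to q.  Every swap is charged either to a small element (it is moved to the
-- left part exactly once) or to a large element found by the index k, so the
-- swaps number #small + #(large positions visited by k).  The same invariant
-- shows that k stops at L + m or L + m + 1, where m is the number of
-- non-large ordinary elements, the latter exactly when position L + m holds
-- a large element.  Hence l@𝒦 counts the large entries among the first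
-- I₁ + I₂ ordinary positions plus one Bernoulli bit for the next position.
--
-- Part 2 is an exchangeability argument.  Writing c(U) for the colour
-- sequence (large or not) of the ordinary elements, part 1 says that T_S is
-- I₁ + hypGplusB (I₁ + I₂) (c U).  Swapping two adjacent ordinary elements is
-- an involution on the permutations of {0..n-1} that preserves I and
-- transposes the colour sequence, so the number of inputs with given I and given
-- colour sequence depends only on the number of reds of the sequence.
-- Summing over colour sequences yields the conditional law as a ratio of
-- counts, which is the cross-multiplied identity of the statement.

open import Defs
open import Data.Bool using (Bool; true; false; if_then_else_; _∧_; not; T)
open import Data.Bool.Properties using (∧-zeroʳ; ∧-identityʳ)
open import Data.Nat using (ℕ; zero; suc; _+_; _*_; _∸_; _≤_; _<_; _≡ᵇ_; _<ᵇ_; _≤ᵇ_; z≤n; s≤s; _⊓_; _<?_)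
open import Data.Nat.Properties
open import Data.Nat.Tactic.RingSolver using (solve-∀)
open import Algebra.Properties.CommutativeSemigroup +-commutativeSemigroup
  using () renaming (interchange to +-interchange)
open import Data.List using (List; []; _∷_; _++_; [_]; length; take; drop; map; concatMap; replicate; upTo)
open import Data.List.Properties
  using (length-take; length-drop; length-map; length-++; length-upTo; take++drop≡id; drop-drop;
         take-map; drop-map; take-take; drop-all; ++-assoc)
open import Data.List.Relation.Unary.All as All using (All; []; _∷_)
open import Data.List.Relation.Unary.Any using (here; there)
open import Data.List.Relation.Unary.AllPairs using (AllPairs; []; _∷_)
open import Data.List.Relation.Unary.Unique.Propositional using (Unique)
import Data.List.Relation.Unary.Unique.Propositional.Properties as Unique
open import Data.List.Membership.Propositional using (_∈_; _∉_; find; lose)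
open import Data.List.Membership.Propositional.Properties
  using (∈-++⁻; ∈-++⁺ˡ; ∈-++⁺ʳ; ∈-map⁺; ∈-map⁻; ∈-∃++; ∈-concatMap⁺; ∈-concatMap⁻)
open import Data.List.Relation.Binary.Permutation.Propositional as ↭ using (_↭_; ↭-sym; ↭-refl; ↭-trans; ↭-prep; ↭⇒↭ₛ)
open import Data.List.Relation.Binary.Permutation.Propositional.Properties
  using (All-resp-↭; ∈-resp-↭; ↭-length; ↭-reverse; shift; drop-∷)
import Data.List.Relation.Binary.Permutation.Setoid.Properties as ↭ₛ
open import Data.Empty using (⊥-elim)
open import Data.Sum using (_⊎_; inj₁; inj₂)
open import Data.Product using (_×_; _,_; proj₂; ∃)
open import Relation.Binary.PropositionalEquality
  using (_≡_; _≢_; refl; sym; trans; cong; cong₂; subst; setoid; module ≡-Reasoning)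
open import Relation.Binary.Definitions using (tri<; tri≈; tri>)
open import Relation.Nullary using (yes; no)

true≢false : true ≢ false
true≢false ()

<ᵇ-true⇒< : ∀ {m n} → (m <ᵇ n) ≡ true → m < n
<ᵇ-true⇒< {m} {n} e = <ᵇ⇒< m n (subst T (sym e) _)

<ᵇ-false⇒≥ : ∀ {m n} → (m <ᵇ n) ≡ false → n ≤ m
<ᵇ-false⇒≥ e = ≮⇒≥ (λ m<n → subst T e (<⇒<ᵇ m<n))

≤ᵇ-true⇒≤ : ∀ {m n} → (m ≤ᵇ n) ≡ true → m ≤ n
≤ᵇ-true⇒≤ {m} {n} e = ≤ᵇ⇒≤ m n (subst T (sym e) _)

≤ᵇ-false⇒> : ∀ {m n} → (m ≤ᵇ n) ≡ false → n < m
≤ᵇ-false⇒> e = ≰⇒> (λ m≤n → subst T e (≤⇒≤ᵇ m≤n))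

≡ᵇ-true⇒≡ : ∀ {m n} → (m ≡ᵇ n) ≡ true → m ≡ n
≡ᵇ-true⇒≡ {m} {n} e = ≡ᵇ⇒≡ m n (subst T (sym e) _)

≡ᵇ-refl : ∀ n → (n ≡ᵇ n) ≡ true
≡ᵇ-refl zero    = refl
≡ᵇ-refl (suc n) = ≡ᵇ-refl n

≡ᵇ-+ˡ : ∀ a x y → (a + x ≡ᵇ a + y) ≡ (x ≡ᵇ y)
≡ᵇ-+ˡ zero    x y = refl
≡ᵇ-+ˡ (suc a) x y = ≡ᵇ-+ˡ a x y

<⇒<ᵇ-true : ∀ {m n} → m < n → (m <ᵇ n) ≡ true
<⇒<ᵇ-true {m} {n} m<n with m <ᵇ n | <⇒<ᵇ m<n
... | true | _ = refl

≥⇒<ᵇ-false : ∀ {m n} → n ≤ m → (m <ᵇ n) ≡ false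
≥⇒<ᵇ-false {m} {n} n≤m with m <ᵇ n in e
... | false = refl
... | true  = ⊥-elim (<⇒≱ (<ᵇ-true⇒< e) n≤m)

indicator : Bool → ℕ
indicator b = if b then 1 else 0

count-cons : ∀ {A : Set} (f : A → Bool) x xs → count f (x ∷ xs) ≡ indicator (f x) + count f xs
count-cons f x xs with f x
... | true  = refl
... | false = refl

count-++ : ∀ {A : Set} (f : A → Bool) xs ys → count f (xs ++ ys) ≡ count f xs + count f ys
count-++ f []       ys = refl
count-++ f (x ∷ xs) ys with f x
... | true  = cong suc (count-++ f xs ys)
... | false = count-++ f xs ys

count-map : ∀ {A B : Set} (f : B → Bool) (g : A → B) xs → count f (map g xs) ≡ count (λ x → f (g x)) xs
count-map f g []       = refl
count-map f g (x ∷ xs) with f (g x)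
... | true  = cong suc (count-map f g xs)
... | false = count-map f g xs

count≤length : ∀ {A : Set} (f : A → Bool) xs → count f xs ≤ length xs
count≤length f []       = z≤n
count≤length f (x ∷ xs) with f x
... | true  = s≤s (count≤length f xs)
... | false = m≤n⇒m≤1+n (count≤length f xs)

count-cong : ∀ {A : Set} (f g : A → Bool) xs → (∀ {x} → x ∈ xs → f x ≡ g x) → count f xs ≡ count g xs
count-cong f g []       h = refl
count-cong f g (x ∷ xs) h with f x | g x | h (here refl) | count-cong f g xs (λ i → h (there i))
... | true  | .true  | refl | ih = cong suc ih
... | false | .false | refl | ih = ih

count-none : ∀ {A : Set} (xs : List A) → count (λ _ → false) xs ≡ 0
count-none []       = refl
count-none (x ∷ xs) = count-none xs

count-∧-const : ∀ {A : Set} (f : A → Bool) b xs → count (λ x → f x ∧ b) xs ≡ (if b then count f xs else 0)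
count-∧-const f true  xs = count-cong _ _ xs (λ {x} _ → ∧-identityʳ (f x))
count-∧-const f false xs = trans (count-cong _ _ xs (λ {x} _ → ∧-zeroʳ (f x))) (count-none xs)

count-disjoint-union : ∀ {A : Set} (f g h : A → Bool) xs →
  All (λ x → indicator (f x) + indicator (g x) ≡ indicator (h x)) xs →
  count f xs + count g xs ≡ count h xs
count-disjoint-union f g h []       []         = refl
count-disjoint-union f g h (x ∷ xs) (px ∷ pxs) =
  begin
    count f (x ∷ xs) + count g (x ∷ xs)
  ≡⟨ cong₂ _+_ (count-cons f x xs) (count-cons g x xs) ⟩
    (indicator (f x) + count f xs) + (indicator (g x) + count g xs)
  ≡⟨ +-interchange (indicator (f x)) (count f xs) (indicator (g x)) (count g xs) ⟩
    (indicator (f x) + indicator (g x)) + (count f xs + count g xs)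
  ≡⟨ cong₂ _+_ px (count-disjoint-union f g h xs pxs) ⟩
    indicator (h x) + count h xs
  ≡⟨ sym (count-cons h x xs) ⟩
    count h (x ∷ xs)
  ∎ where open ≡-Reasoning

count-↭ : ∀ {A : Set} (f : A → Bool) {xs ys} → xs ↭ ys → count f xs ≡ count f ys
count-↭ f ↭.refl = refl
count-↭ f (↭.prep x p) with f x
... | true  = cong suc (count-↭ f p)
... | false = count-↭ f p
count-↭ f (↭.swap x y p) with f x | f y
... | true  | true  = cong (λ z → suc (suc z)) (count-↭ f p)
... | true  | false = cong suc (count-↭ f p)
... | false | true  = cong suc (count-↭ f p)
... | false | false = count-↭ f p
count-↭ f (↭.trans p q) = trans (count-↭ f p) (count-↭ f q)

below : (ℕ → Bool) → ℕ → ℕ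
below P zero    = 0
below P (suc j) = if P j then suc (below P j) else below P j

below-true : ∀ P j → P j ≡ true → below P (suc j) ≡ suc (below P j)
below-true P j e = cong (λ b → if b then suc (below P j) else below P j) e

below-false : ∀ P j → P j ≡ false → below P (suc j) ≡ below P j
below-false P j e = cong (λ b → if b then suc (below P j) else below P j) e

below-complement : ∀ P j → below P j + below (λ i → not (P i)) j ≡ j
below-complement P zero    = refl
below-complement P (suc j) with P j
... | true  = cong suc (below-complement P j)
... | false = trans (+-suc (below P j) _) (cong suc (below-complement P j))

swapA-elsewhere : ∀ A a b i → i ≢ a → i ≢ b → swapA A a b i ≡ A i
swapA-elsewhere A a b i i≢a i≢b with i ≡ᵇ a in e₁
... | true  = ⊥-elim (i≢a (≡ᵇ-true⇒≡ e₁))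
... | false with i ≡ᵇ b in e₂
...   | true  = ⊥-elim (i≢b (≡ᵇ-true⇒≡ e₂))
...   | false = refl

-- Analysis of one run of Yaroslavskiy's partitioning loop on the range
-- [L..R] of an array A0, with pivots p ≤ q, where no entry of the range
-- equals q (so "A[k] ≥ q" means "A[k] is large").
module Yaroslavskiy (A0 : ℕ → ℕ) (p q L R : ℕ) (1≤L : 1 ≤ L) (p≤q : p ≤ q)
                    (no-q : ∀ i → L ≤ i → i ≤ R → A0 i ≢ q) where

  small large notLarge : ℕ → Bool
  small i    = A0 i <ᵇ p
  large i    = q <ᵇ A0 i
  notLarge i = not (large i)

  nSmall nLarge nNotLarge : ℕ → ℕ
  nSmall    = below small
  nLarge    = below large
  nNotLarge = below notLarge

  small⇒¬large : ∀ i → small i ≡ true → large i ≡ false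
  small⇒¬large i e = ≥⇒<ᵇ-false (≤-trans (<⇒≤ (<ᵇ-true⇒< e)) p≤q)

  large⇒¬small : ∀ i → large i ≡ true → small i ≡ false
  large⇒¬small i e with small i in e′
  ... | false = refl
  ... | true  = ⊥-elim (true≢false (trans (sym e) (small⇒¬large i e′)))

  Untouched : (ℕ → ℕ) → ℕ → ℕ → Set
  Untouched A k g = ∀ i → k ≤ i → i ≤ g → A i ≡ A0 i

  record InnerScan (k g g′ : ℕ) : Set where
    field
      k≤g′       : k ≤ g′
      g′≤g       : g′ ≤ g
      skip-small : nSmall (suc g) ≡ nSmall (suc g′)
      skip-nl    : nNotLarge (suc g) ≡ nNotLarge (suc g′)
      stop       : g′ ≡ k ⊎ (k < g′ × large g′ ≡ false)

  innerG-scan : ∀ A k g → k ≤ g → Untouched A k g → InnerScan k g (innerG A q k g)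
  innerG-scan A .zero zero z≤n _ =
    record { k≤g′ = z≤n ; g′≤g = z≤n ; skip-small = refl ; skip-nl = refl ; stop = inj₁ refl }
  innerG-scan A k (suc g) k≤g un with q <ᵇ A (suc g) in e₁ | k <ᵇ suc g in e₂
  ... | true | true =
    record { k≤g′ = k≤g′ ; g′≤g = m≤n⇒m≤1+n g′≤g
           ; skip-small = trans (below-false small (suc g) (large⇒¬small (suc g) large-g)) skip-small
           ; skip-nl = trans (below-false notLarge (suc g) (cong not large-g)) skip-nl ; stop = stop }
    where
    open InnerScan (innerG-scan A k g (≤-pred (<ᵇ-true⇒< e₂)) (λ i a b → un i a (m≤n⇒m≤1+n b)))
    large-g : large (suc g) ≡ true
    large-g = trans (cong (q <ᵇ_) (sym (un (suc g) k≤g ≤-refl))) e₁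
  ... | true | false =
    record { k≤g′ = k≤g ; g′≤g = ≤-refl ; skip-small = refl ; skip-nl = refl
           ; stop = inj₁ (≤-antisym (<ᵇ-false⇒≥ e₂) k≤g) }
  ... | false | _ with k <ᵇ suc g in e₃
  ...   | true  = record { k≤g′ = k≤g ; g′≤g = ≤-refl ; skip-small = refl ; skip-nl = refl
                         ; stop = inj₂ (<ᵇ-true⇒< e₃ , trans (cong (q <ᵇ_) (sym (un (suc g) k≤g ≤-refl))) e₁) }
  ...   | false = record { k≤g′ = k≤g ; g′≤g = ≤-refl ; skip-small = refl ; skip-nl = refl
                         ; stop = inj₁ (≤-antisym (<ᵇ-false⇒≥ e₃) k≤g) }

  -- Swap accounting: swaps so far, plus the small entries left of L, plus
  -- the large entries in [L, k), plus the small entries up to g, equals the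
  -- small and large entries below k plus all small entries up to R.  At the
  -- end this says swaps = #small in [L..R] + #large visited by k.
  SwapBalance : ℕ → ℕ → ℕ → Set
  SwapBalance sw g k = sw + nSmall L + nLarge L + nSmall (suc g) ≡ nSmall k + nLarge k + nSmall (suc R)

  -- The exceptional configuration arises when the inner loop
  -- stops at g' = k on a large entry: then k = g + 2 has passed it.
  record Aligned (k g : ℕ) : Set where
    field
      k≤g+1    : k ≤ suc g
      balance  : nLarge k + nNotLarge (suc g) ≡ nLarge L + nNotLarge (suc R)
      beyond-g : g < R → large (suc g) ≡ false

  record Overshot (k g : ℕ) : Set where
    field
      k≡g+2    : k ≡ suc (suc g)
      large-g+1 : large (suc g) ≡ true
      balance  : nLarge k + nNotLarge (suc g) ≡ suc (nLarge L + nNotLarge (suc R))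
      g+1≤R    : suc g ≤ R

  record Invariant (s : State) : Set where
    constructor invariant
    field
      ℓ≤k      : State.ℓ s ≤ State.k s
      L≤k      : L ≤ State.k s
      g≤R      : State.g s ≤ R
      untouched : Untouched (State.arr s) (State.k s) (State.g s)
      swaps    : SwapBalance (State.swaps s) (State.g s) (State.k s)
      visited  : count large (State.visited s) + nLarge L ≡ nLarge (State.k s)
      shape    : Aligned (State.k s) (State.g s) ⊎ Overshot (State.k s) (State.g s)

  visit : ∀ k vis → count large vis + nLarge L ≡ nLarge k → count large (k ∷ vis) + nLarge L ≡ nLarge (suc k)
  visit k vis h with large k
  ... | true  = cong suc h
  ... | false = h

  balance-small : ∀ sw g k → small k ≡ true → SwapBalance sw g k → SwapBalance (suc sw) g (suc k)
  balance-small sw g k e h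
    rewrite below-true small k e | below-false large k (small⇒¬large k e) = cong suc h

  balance-medium : ∀ sw g k → small k ≡ false → large k ≡ false → SwapBalance sw g k → SwapBalance sw g (suc k)
  balance-medium sw g k e₁ e₂ h rewrite below-false small k e₁ | below-false large k e₂ = h

  -- In the large branch, k's large entry is counted and the inner loop
  -- skipped no small entry; one swap exchanges A[k] with A[g'], and a second
  -- swap is needed exactly when A[g'] is small (and then g' leaves the
  -- region up to g).
  balance-large : ∀ sw g k g″ → large k ≡ true → nSmall (suc g) ≡ nSmall (suc (suc g″)) →
                  SwapBalance sw g k →
                  suc sw + nSmall L + nLarge L + nSmall (suc (suc g″)) ≡ nSmall (suc k) + nLarge (suc k) + nSmall (suc R)
  balance-large sw g k g″ e skip h
    rewrite below-false small k (large⇒¬small k e) | below-true large k e =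
    begin
      suc (sw + nSmall L + nLarge L + nSmall (suc (suc g″)))
    ≡⟨ cong (λ x → suc (sw + nSmall L + nLarge L + x)) (sym skip) ⟩
      suc (sw + nSmall L + nLarge L + nSmall (suc g))
    ≡⟨ cong suc h ⟩
      suc (nSmall k + nLarge k + nSmall (suc R))
    ≡⟨ cong (_+ nSmall (suc R)) (sym (+-suc (nSmall k) (nLarge k))) ⟩
      nSmall k + suc (nLarge k) + nSmall (suc R)
    ∎ where open ≡-Reasoning

  balance-large-medium : ∀ sw g k g″ → large k ≡ true → nSmall (suc g) ≡ nSmall (suc (suc g″)) →
                         small (suc g″) ≡ false → SwapBalance sw g k → SwapBalance (suc sw) g″ (suc k)
  balance-large-medium sw g k g″ e skip e′ h =
    trans (cong (λ x → suc sw + nSmall L + nLarge L + x) (sym (below-false small (suc g″) e′)))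
          (balance-large sw g k g″ e skip h)

  balance-large-small : ∀ sw g k g″ → large k ≡ true → nSmall (suc g) ≡ nSmall (suc (suc g″)) →
                        small (suc g″) ≡ true → SwapBalance sw g k → SwapBalance (suc (suc sw)) g″ (suc k)
  balance-large-small sw g k g″ e skip e′ h =
    trans (sym (+-suc (suc sw + nSmall L + nLarge L) (nSmall (suc g″))))
          (trans (cong (λ x → suc sw + nSmall L + nLarge L + x) (sym (below-true small (suc g″) e′)))
                 (balance-large sw g k g″ e skip h))

  aligned-advance : ∀ k g → large k ≡ false → k ≤ g → Aligned k g → Aligned (suc k) g
  aligned-advance k g e k≤g a = record
    { k≤g+1 = s≤s k≤g
    ; balance = trans (cong (_+ nNotLarge (suc g)) (below-false large k e)) (Aligned.balance a)
    ; beyond-g = Aligned.beyond-g a }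

  -- A large A[k] is matched by the non-large entry at the stop position g'.
  aligned-large : ∀ k g g″ → k ≤ g″ → large k ≡ true → nNotLarge (suc g) ≡ nNotLarge (suc (suc g″)) →
                  large (suc g″) ≡ false → Aligned k g → Aligned (suc k) g″
  aligned-large k g g″ k≤g″ e skip e′ a = record { k≤g+1 = s≤s k≤g″ ; balance = balance′ ; beyond-g = λ _ → e′ }
    where
    open ≡-Reasoning
    balance′ : nLarge (suc k) + nNotLarge (suc g″) ≡ nLarge L + nNotLarge (suc R)
    balance′ = begin
        nLarge (suc k) + nNotLarge (suc g″)
      ≡⟨ cong (_+ nNotLarge (suc g″)) (below-true large k e) ⟩
        suc (nLarge k + nNotLarge (suc g″))
      ≡⟨ sym (+-suc (nLarge k) _) ⟩
        nLarge k + suc (nNotLarge (suc g″))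
      ≡⟨ cong (nLarge k +_) (sym (below-true notLarge (suc g″) (cong not e′))) ⟩
        nLarge k + nNotLarge (suc (suc g″))
      ≡⟨ cong (nLarge k +_) (sym skip) ⟩
        nLarge k + nNotLarge (suc g)
      ≡⟨ Aligned.balance a ⟩
        nLarge L + nNotLarge (suc R)
      ∎

  overshoot : ∀ g g″ → large (suc g″) ≡ true → nNotLarge (suc g) ≡ nNotLarge (suc (suc g″)) → suc g″ ≤ R →
              Aligned (suc g″) g → Overshot (suc (suc g″)) g″
  overshoot g g″ e skip g′≤R a = record { k≡g+2 = refl ; large-g+1 = e ; balance = balance′ ; g+1≤R = g′≤R }
    where
    open ≡-Reasoning
    balance′ : nLarge (suc (suc g″)) + nNotLarge (suc g″) ≡ suc (nLarge L + nNotLarge (suc R))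
    balance′ = begin
        nLarge (suc (suc g″)) + nNotLarge (suc g″)
      ≡⟨ cong (_+ nNotLarge (suc g″)) (below-true large (suc g″) e) ⟩
        suc (nLarge (suc g″) + nNotLarge (suc g″))
      ≡⟨ cong (λ x → suc (nLarge (suc g″) + x)) (sym (below-false notLarge (suc g″) (cong not e))) ⟩
        suc (nLarge (suc g″) + nNotLarge (suc (suc g″)))
      ≡⟨ cong (λ x → suc (nLarge (suc g″) + x)) (sym skip) ⟩
        suc (nLarge (suc g″) + nNotLarge (suc g))
      ≡⟨ cong suc (Aligned.balance a) ⟩
        suc (nLarge L + nNotLarge (suc R))
      ∎

  untouched-shrink : ∀ {A k g k′ g′} → Untouched A k g → k ≤ k′ → g′ ≤ g → Untouched A k′ g′
  untouched-shrink un k≤k′ g′≤g i k′≤i i≤g′ = un i (≤-trans k≤k′ k′≤i) (≤-trans i≤g′ g′≤g)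

  untouched-swap : ∀ {A k g} a b → Untouched A k g →
                   (∀ i → k ≤ i → i ≤ g → i ≢ a) → (∀ i → k ≤ i → i ≤ g → i ≢ b) →
                   Untouched (swapA A a b) k g
  untouched-swap {A} a b un away-a away-b i k≤i i≤g =
    trans (swapA-elsewhere A a b i (away-a i k≤i i≤g) (away-b i k≤i i≤g)) (un i k≤i i≤g)

  StepOK : State → State → Set
  StepOK s s′ = Invariant s′ × State.g s′ ≤ State.g s × State.k s′ ≡ suc (State.k s)

  step-small : ∀ A ℓ g k sw vis → Invariant (st A ℓ g k sw vis) → Aligned k g → k ≤ g → (A k <ᵇ p) ≡ true →
               StepOK (st A ℓ g k sw vis) (st (swapA A k ℓ) (suc ℓ) g (suc k) (suc sw) (k ∷ vis))
  step-small A ℓ g k sw vis (invariant ℓ≤k L≤k g≤R un bal vis-ok _) a k≤g e =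
    invariant (s≤s ℓ≤k) (m≤n⇒m≤1+n L≤k) g≤R
      (untouched-swap k ℓ (untouched-shrink un (n≤1+n k) ≤-refl)
         (λ i k<i _ → >⇒≢ k<i) (λ i k<i _ → >⇒≢ (<-≤-trans (s≤s ℓ≤k) k<i)))
      (balance-small sw g k small-k bal) (visit k vis vis-ok)
      (inj₁ (aligned-advance k g (small⇒¬large k small-k) k≤g a)) ,
    ≤-refl , refl
    where
    small-k : small k ≡ true
    small-k = trans (cong (_<ᵇ p) (sym (un k ≤-refl k≤g))) e

  step-medium : ∀ A ℓ g k sw vis → Invariant (st A ℓ g k sw vis) → Aligned k g → k ≤ g →
                (A k <ᵇ p) ≡ false → (q ≤ᵇ A k) ≡ false →
                StepOK (st A ℓ g k sw vis) (st A ℓ g (suc k) sw (k ∷ vis))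
  step-medium A ℓ g k sw vis (invariant ℓ≤k L≤k g≤R un bal vis-ok _) a k≤g e₁ e₂ =
    invariant (m≤n⇒m≤1+n ℓ≤k) (m≤n⇒m≤1+n L≤k) g≤R (untouched-shrink un (n≤1+n k) ≤-refl)
      (balance-medium sw g k small-k large-k bal) (visit k vis vis-ok)
      (inj₁ (aligned-advance k g large-k k≤g a)) ,
    ≤-refl , refl
    where
    small-k : small k ≡ false
    small-k = trans (cong (_<ᵇ p) (sym (un k ≤-refl k≤g))) e₁
    large-k : large k ≡ false
    large-k = ≥⇒<ᵇ-false (≤-trans (≤-reflexive (sym (un k ≤-refl k≤g))) (<⇒≤ (≤ᵇ-false⇒> e₂)))

  -- A[k] ≥ q means A[k] is large, since no entry equals q.
  large-at-k : ∀ A k g → L ≤ k → g ≤ R → k ≤ g → Untouched A k g → (q ≤ᵇ A k) ≡ true → large k ≡ true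
  large-at-k A k g L≤k g≤R k≤g un e =
    <⇒<ᵇ-true (≤∧≢⇒< (≤-trans (≤ᵇ-true⇒≤ e) (≤-reflexive (un k ≤-refl k≤g)))
                      (λ eq → no-q k L≤k (≤-trans k≤g g≤R) (sym eq)))

  -- Large A[k], the inner loop stops at g' = g″ + 1 with A[g'] not small:
  -- one swap.  If g' = k the pointers have crossed on a large entry.
  step-large-medium : ∀ A ℓ g k sw vis g″ → Invariant (st A ℓ g k sw vis) → Aligned k g →
                      k ≤ g → (q ≤ᵇ A k) ≡ true → InnerScan k g (suc g″) → (p ≤ᵇ A (suc g″)) ≡ true →
                      StepOK (st A ℓ g k sw vis) (st (swapA A k (suc g″)) ℓ g″ (suc k) (suc sw) (k ∷ vis))
  step-large-medium A ℓ g k sw vis g″ (invariant ℓ≤k L≤k g≤R un bal vis-ok _) a k≤g e₂ scan e₃ =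
    invariant (m≤n⇒m≤1+n ℓ≤k) (m≤n⇒m≤1+n L≤k) (≤-trans (n≤1+n g″) g′≤R) un′
      (balance-large-medium sw g k g″ large-k skip-small small-g′ bal) (visit k vis vis-ok) shape′ ,
    ≤-trans (n≤1+n g″) g′≤g , refl
    where
    open InnerScan scan
    large-k = large-at-k A k g L≤k g≤R k≤g un e₂
    small-g′ : small (suc g″) ≡ false
    small-g′ = ≥⇒<ᵇ-false (≤-trans (≤ᵇ-true⇒≤ {p} e₃) (≤-reflexive (un (suc g″) k≤g′ g′≤g)))
    g′≤R = ≤-trans g′≤g g≤R
    un′ : Untouched (swapA A k (suc g″)) (suc k) g″
    un′ = untouched-swap k (suc g″) (untouched-shrink un (n≤1+n k) (≤-trans (n≤1+n g″) g′≤g))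
            (λ i k<i _ → >⇒≢ k<i) (λ i _ i≤g″ → <⇒≢ (s≤s i≤g″))
    shape′ : Aligned (suc k) g″ ⊎ Overshot (suc k) g″
    shape′ with stop
    ... | inj₁ refl          = inj₂ (overshoot g g″ large-k skip-nl g′≤R a)
    ... | inj₂ (k<g′ , nl-g′) = inj₁ (aligned-large k g g″ (≤-pred k<g′) large-k skip-nl nl-g′ a)

  -- Large A[k], the inner loop stops at g' = g″ + 1 with A[g'] small: two
  -- swaps (A[g'] goes to the left part).  Here g' ≠ k since A[k] is large.
  step-large-small : ∀ A ℓ g k sw vis g″ → Invariant (st A ℓ g k sw vis) → Aligned k g →
                     k ≤ g → (q ≤ᵇ A k) ≡ true → InnerScan k g (suc g″) → (p ≤ᵇ A (suc g″)) ≡ false →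
                     StepOK (st A ℓ g k sw vis)
                            (st (swapA (swapA A k (suc g″)) k ℓ) (suc ℓ) g″ (suc k) (suc (suc sw)) (k ∷ vis))
  step-large-small A ℓ g k sw vis g″ (invariant ℓ≤k L≤k g≤R un bal vis-ok _) a k≤g e₂ scan e₃ =
    invariant (s≤s ℓ≤k) (m≤n⇒m≤1+n L≤k) (≤-trans (n≤1+n g″) (≤-trans g′≤g g≤R)) un′
      (balance-large-small sw g k g″ large-k skip-small small-g′ bal) (visit k vis vis-ok) shape′ ,
    ≤-trans (n≤1+n g″) g′≤g , refl
    where
    open InnerScan scan
    large-k = large-at-k A k g L≤k g≤R k≤g un e₂
    small-g′ : small (suc g″) ≡ true
    small-g′ = <⇒<ᵇ-true (<-≤-trans (s≤s (≤-reflexive (sym (un (suc g″) k≤g′ g′≤g)))) (≤ᵇ-false⇒> {p} e₃))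
    un′ : Untouched (swapA (swapA A k (suc g″)) k ℓ) (suc k) g″
    un′ = untouched-swap k ℓ
            (untouched-swap k (suc g″) (untouched-shrink un (n≤1+n k) (≤-trans (n≤1+n g″) g′≤g))
               (λ i k<i _ → >⇒≢ k<i) (λ i _ i≤g″ → <⇒≢ (s≤s i≤g″)))
            (λ i k<i _ → >⇒≢ k<i) (λ i k<i _ → >⇒≢ (<-≤-trans (s≤s ℓ≤k) k<i))
    shape′ : Aligned (suc k) g″ ⊎ Overshot (suc k) g″
    shape′ with stop
    ... | inj₁ refl          = ⊥-elim (true≢false (trans (sym small-g′) (large⇒¬small (suc g″) large-k)))
    ... | inj₂ (k<g′ , nl-g′) = inj₁ (aligned-large k g g″ (≤-pred k<g′) large-k skip-nl nl-g′ a)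

  step-ok : ∀ A ℓ g k sw vis → Invariant (st A ℓ g k sw vis) → k ≤ g →
            StepOK (st A ℓ g k sw vis) (step p q (st A ℓ g k sw vis))
  step-ok A ℓ g k sw vis I k≤g with Invariant.shape I
  ... | inj₂ o = ⊥-elim (<⇒≱ (≤-reflexive (sym (Overshot.k≡g+2 o))) (m≤n⇒m≤1+n k≤g))
  ... | inj₁ a with A k <ᵇ p in e₁
  ...   | true = step-small A ℓ g k sw vis I a k≤g e₁
  ...   | false with q ≤ᵇ A k in e₂
  ...     | false = step-medium A ℓ g k sw vis I a k≤g e₁ e₂
  ...     | true with innerG A q k g | innerG-scan A k g k≤g (Invariant.untouched I)
  ...       | zero | scan = ⊥-elim (1+n≰n (≤-trans (≤-trans 1≤L (Invariant.L≤k I)) (InnerScan.k≤g′ scan)))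
  ...       | suc g″ | scan with p ≤ᵇ A (suc g″) in e₃
  ...         | true  = step-large-medium A ℓ g k sw vis g″ I a k≤g e₂ scan e₃
  ...         | false = step-large-small A ℓ g k sw vis g″ I a k≤g e₂ scan e₃

  loop-ok : ∀ f s → Invariant s → State.g s < State.k s + f →
            Invariant (loop f p q s) × State.g (loop f p q s) < State.k (loop f p q s)
  loop-ok zero    s I g<k+0 = I , subst (State.g s <_) (+-identityʳ _) g<k+0
  loop-ok (suc f) (st A ℓ g k sw vis) I g<k+f with k ≤ᵇ g in e
  ... | false = I , ≤ᵇ-false⇒> e
  ... | true with step-ok A ℓ g k sw vis I (≤ᵇ-true⇒≤ e)
  ...   | I′ , g′≤g , k′≡k+1 = loop-ok f _ I′
            (≤-trans (s≤s g′≤g) (≤-trans g<k+f (≤-reflexive (trans (+-suc k f) (cong (_+ f) (sym k′≡k+1))))))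

  initial-ok : L ≤ suc R → Invariant (st A0 L R L 0 [])
  initial-ok L≤R+1 = invariant ≤-refl ≤-refl ≤-refl (λ i _ _ → refl) refl refl
    (inj₁ (record { k≤g+1 = L≤R+1 ; balance = refl ; beyond-g = λ R<R → ⊥-elim (1+n≰n R<R) }))

  record Outcome (sw k cnt m : ℕ) : Set where
    field
      swaps   : sw + nSmall L ≡ cnt + nSmall (suc R)
      visited : cnt + nLarge L ≡ nLarge k
      final-k : (k ≡ L + m × (L + m ≤ R → large (L + m) ≡ false))
              ⊎ (k ≡ suc (L + m) × large (L + m) ≡ true × L + m ≤ R)

  final-swaps : ∀ sw g k cnt → SwapBalance sw g k → cnt + nLarge L ≡ nLarge k → nSmall k ≡ nSmall (suc g) →
                sw + nSmall L ≡ cnt + nSmall (suc R)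
  final-swaps sw g k cnt bal vis k~g+1 = +-cancelʳ-≡ (nLarge L + nSmall (suc g)) (sw + nSmall L) (cnt + nSmall (suc R))
    (begin
      sw + nSmall L + (nLarge L + nSmall (suc g))
    ≡⟨ reassoc sw (nSmall L) (nLarge L) (nSmall (suc g)) ⟩
      sw + nSmall L + nLarge L + nSmall (suc g)
    ≡⟨ bal ⟩
      nSmall k + nLarge k + nSmall (suc R)
    ≡⟨ cong₂ (λ a b → a + b + nSmall (suc R)) k~g+1 (sym vis) ⟩
      nSmall (suc g) + (cnt + nLarge L) + nSmall (suc R)
    ≡⟨ regroup (nSmall (suc g)) cnt (nLarge L) (nSmall (suc R)) ⟩
      cnt + nSmall (suc R) + (nLarge L + nSmall (suc g))
    ∎)
    where
    open ≡-Reasoning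
    reassoc : ∀ a b c d → a + b + (c + d) ≡ a + b + c + d
    reassoc = solve-∀
    regroup : ∀ s c l r → s + (c + l) + r ≡ c + r + (l + s)
    regroup = solve-∀

  final-position : ∀ k m x → nNotLarge L + m ≡ nNotLarge (suc R) →
                   nLarge k + nNotLarge k ≡ x + (nLarge L + nNotLarge (suc R)) → k ≡ x + (L + m)
  final-position k m x m-def bal = begin
      k                                          ≡⟨ sym (below-complement large k) ⟩
      nLarge k + nNotLarge k                     ≡⟨ bal ⟩
      x + (nLarge L + nNotLarge (suc R))         ≡⟨ cong (λ y → x + (nLarge L + y)) (sym m-def) ⟩
      x + (nLarge L + (nNotLarge L + m))         ≡⟨ cong (x +_) (sym (+-assoc (nLarge L) (nNotLarge L) m)) ⟩
      x + (nLarge L + nNotLarge L + m)           ≡⟨ cong (λ y → x + (y + m)) (below-complement large L) ⟩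
      x + (L + m)                                ∎
    where open ≡-Reasoning

  outcome : ∀ s m → nNotLarge L + m ≡ nNotLarge (suc R) → Invariant s → State.g s < State.k s →
            Outcome (State.swaps s) (State.k s) (count large (State.visited s)) m
  outcome (st A ℓ g k sw vis) m m-def (invariant _ _ _ _ bal vis-ok (inj₁ a)) g<k = record
    { swaps = final-swaps sw g k _ bal vis-ok (cong nSmall k≡g+1) ; visited = vis-ok
    ; final-k = inj₁ (k≡L+m , λ L+m≤R → subst (λ i → large i ≡ false) g+1≡L+m
                               (Aligned.beyond-g a (≤-trans (≤-reflexive g+1≡L+m) L+m≤R))) }
    where
    k≡g+1 : k ≡ suc g
    k≡g+1 = ≤-antisym (Aligned.k≤g+1 a) g<k
    k≡L+m : k ≡ L + m
    k≡L+m = final-position k m 0 m-def (trans (cong (λ i → nLarge k + nNotLarge i) k≡g+1) (Aligned.balance a))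
    g+1≡L+m : suc g ≡ L + m
    g+1≡L+m = trans (sym k≡g+1) k≡L+m
  outcome (st A ℓ g k sw vis) m m-def (invariant _ _ _ _ bal vis-ok (inj₂ o)) g<k = record
    { swaps = final-swaps sw g k _ bal vis-ok k~g+1 ; visited = vis-ok
    ; final-k = inj₂ (trans k≡g+2 (cong suc g+1≡L+m) , subst (λ i → large i ≡ true) g+1≡L+m large-g+1
                     , subst (_≤ R) g+1≡L+m g+1≤R) }
    where
    open Overshot o
    k~g+1 : nSmall k ≡ nSmall (suc g)
    k~g+1 = trans (cong nSmall k≡g+2) (below-false small (suc g) (large⇒¬small (suc g) large-g+1))
    g+1≡L+m : suc g ≡ L + m
    g+1≡L+m = suc-injective (trans (sym k≡g+2) (final-position k m 1 m-def
      (trans (cong (nLarge k +_) (trans (cong nNotLarge k≡g+2) (below-false notLarge (suc g) (cong not large-g+1))))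
             balance)))

  run-outcome : ∀ f m → L ≤ suc R → R < L + f → nNotLarge L + m ≡ nNotLarge (suc R) →
                let s = loop f p q (st A0 L R L 0 []) in
                Outcome (State.swaps s) (State.k s) (count large (State.visited s)) m
  run-outcome f m L≤R+1 R<L+f m-def with loop-ok f (st A0 L R L 0 []) (initial-ok L≤R+1) R<L+f
  ... | I , g<k = outcome _ m m-def I g<k

insert-↭ : ∀ x ys → insert x ys ↭ x ∷ ys
insert-↭ x []       = ↭-refl
insert-↭ x (y ∷ ys) with x ≤ᵇ y
... | true  = ↭-refl
... | false = ↭-trans (↭-prep y (insert-↭ x ys)) (↭.swap y x ↭-refl)

sort-↭ : ∀ xs → sort xs ↭ xs
sort-↭ []       = ↭-refl
sort-↭ (x ∷ xs) = ↭-trans (insert-↭ x (sort xs)) (↭-prep x (sort-↭ xs))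

Sorted : List ℕ → Set
Sorted = AllPairs _≤_

insert-sorted : ∀ x ys → Sorted ys → Sorted (insert x ys)
insert-sorted x []       []           = [] ∷ []
insert-sorted x (y ∷ ys) (y≤ys ∷ sys) with x ≤ᵇ y in e
... | true  = (≤ᵇ-true⇒≤ e ∷ All.map (≤-trans (≤ᵇ-true⇒≤ e)) y≤ys) ∷ y≤ys ∷ sys
... | false = All-resp-↭ (↭-sym (insert-↭ x ys)) (<⇒≤ (≤ᵇ-false⇒> e) ∷ y≤ys) ∷ insert-sorted x ys sys

sort-sorted : ∀ xs → Sorted (sort xs)
sort-sorted []       = []
sort-sorted (x ∷ xs) = insert-sorted x (sort xs) (sort-sorted xs)

nth-∈ : ∀ xs i → i < length xs → nth xs i ∈ xs
nth-∈ (x ∷ xs) zero    _         = here refl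
nth-∈ (x ∷ xs) (suc i) (s≤s i<n) = there (nth-∈ xs i i<n)

nth-mono : ∀ xs i j → Sorted xs → i ≤ j → j < length xs → nth xs i ≤ nth xs j
nth-mono (x ∷ xs) zero    zero    _            _         _         = ≤-refl
nth-mono (x ∷ xs) zero    (suc j) (x≤xs ∷ _)   _         (s≤s j<n) = All.lookup x≤xs (nth-∈ xs j j<n)
nth-mono (x ∷ xs) (suc i) (suc j) (_ ∷ sxs)    (s≤s i≤j) (s≤s j<n) = nth-mono xs i j sxs i≤j j<n

nth-take : ∀ xs N j → j < N → nth (take N xs) j ≡ nth xs j
nth-take []       (suc N) j       _         = refl
nth-take (x ∷ xs) (suc N) zero    _         = refl
nth-take (x ∷ xs) (suc N) (suc j) (s≤s j<N) = nth-take xs N j j<N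

nth-drop : ∀ xs a j → nth (drop a xs) j ≡ nth xs (a + j)
nth-drop xs       zero    j = refl
nth-drop []       (suc a) j = refl
nth-drop (x ∷ xs) (suc a) j = nth-drop xs a j

drop-nth : ∀ (U : List ℕ) d → d < length U → drop d U ≡ nth U d ∷ drop (suc d) U
drop-nth (x ∷ U) zero    _         = refl
drop-nth (x ∷ U) (suc d) (s≤s d<n) = drop-nth U d d<n

-- Prefix counts of array positions versus counts over a window of U:
-- positions d+1 .. d+len of the array hold take len (drop d U).
below-window : ∀ (f : ℕ → Bool) U d len → d + len ≤ length U →
  below (λ i → f (array U i)) (suc d + len) ≡ below (λ i → f (array U i)) (suc d) + count f (take len (drop d U))
below-window f U d zero    _ = trans (cong (below _) (+-identityʳ (suc d))) (sym (+-identityʳ _))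
below-window f U d (suc len) d+len<n
  rewrite drop-nth U d (<-≤-trans (s≤s (m≤m+n d len)) (≤-trans (≤-reflexive (sym (+-suc d len))) d+len<n))
        | +-suc d len
  with below-window f U (suc d) len d+len<n
... | ih with f (nth U d)
...   | true  = trans ih (sym (+-suc _ _))
...   | false = ih

unique-++-disjoint : ∀ {x : ℕ} xs {ys} → Unique (xs ++ ys) → x ∈ xs → x ∉ ys
unique-++-disjoint (x₀ ∷ xs) (x₀∉ ∷ u) (here refl) x∈ys = All.lookup x₀∉ (∈-++⁺ʳ xs x∈ys) refl
unique-++-disjoint (x₀ ∷ xs) (_ ∷ u)   (there x∈xs) x∈ys = unique-++-disjoint xs u x∈xs x∈ys

unique-++ʳ : ∀ xs {ys : List ℕ} → Unique (xs ++ ys) → Unique ys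
unique-++ʳ []       u       = u
unique-++ʳ (x ∷ xs) (_ ∷ u) = unique-++ʳ xs u

unique-middle : ∀ {x : ℕ} X O Y → Unique (X ++ O ++ Y) → x ∈ O → x ∉ X ++ Y
unique-middle X O Y u x∈O x∈XY with ∈-++⁻ X x∈XY
... | inj₁ x∈X = unique-++-disjoint X u x∈X (∈-++⁺ˡ x∈O)
... | inj₂ x∈Y = unique-++-disjoint O (unique-++ʳ X u) x∈O x∈Y

-- Layout of the input U (array positions are 1-based): positions 1..nLeft
-- hold the left part of the sample, positions L..R the nOrd ordinary
-- elements, and the last t3 + 1 positions the right part of the sample.
module Layout (t1 t2 t3 : ℕ) (U : List ℕ) (k≤n : kOf t1 t2 t3 ≤ length U) where

  nLeft nOrd L R : ℕ
  nLeft = t1 + t2 + 1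
  nOrd  = length U ∸ kOf t1 t2 t3
  L     = leftOf t1 t2 t3 U
  R     = rightOf t1 t2 t3 U

  S O : List ℕ
  S = sample t1 t2 t3 U
  O = ordinary t1 t2 t3 U

  L≡ : L ≡ suc nLeft
  L≡ = +-suc (t1 + t2) 1

  R≡ : R ≡ nLeft + nOrd
  R≡ = begin
      length U ∸ (t3 + 1)
    ≡⟨ cong (_∸ (t3 + 1)) (sym (m∸n+n≡m k≤n)) ⟩
      nOrd + (t1 + t2 + t3 + 2) ∸ (t3 + 1)
    ≡⟨ cong (_∸ (t3 + 1)) (regroup nOrd t1 t2 t3) ⟩
      (nLeft + nOrd) + (t3 + 1) ∸ (t3 + 1)
    ≡⟨ m+n∸n≡m (nLeft + nOrd) (t3 + 1) ⟩
      nLeft + nOrd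
    ∎
    where
    open ≡-Reasoning
    regroup : ∀ N t1 t2 t3 → N + (t1 + t2 + t3 + 2) ≡ (t1 + t2 + 1 + N) + (t3 + 1)
    regroup = solve-∀

  1≤L : 1 ≤ L
  1≤L = ≤-trans (s≤s z≤n) (≤-reflexive (sym L≡))

  L≤R+1 : L ≤ suc R
  L≤R+1 = ≤-trans (≤-reflexive L≡) (s≤s (≤-trans (m≤m+n nLeft nOrd) (≤-reflexive (sym R≡))))

  left+ord≤n : nLeft + nOrd ≤ length U
  left+ord≤n = subst (_≤ length U) R≡ (m∸n≤m (length U) (t3 + 1))

  length-ordinary : length O ≡ nOrd
  length-ordinary = trans (length-take nOrd (drop nLeft U)) (trans (cong (nOrd ⊓_) (length-drop nLeft U))
    (m≤n⇒m⊓n≡m (≤-trans (≤-reflexive (sym (m+n∸m≡n nLeft nOrd))) (∸-monoˡ-≤ nLeft left+ord≤n))))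

  nth-ordinary : ∀ j → j < nOrd → nth O j ≡ array U (L + j)
  nth-ordinary j j<N = trans (nth-take (drop nLeft U) nOrd j j<N)
                             (trans (nth-drop U nLeft j) (cong (λ i → array U (i + j)) (sym L≡)))

  below-ordinary : ∀ (f : ℕ → Bool) →
    below (λ i → f (array U i)) (suc R) ≡ below (λ i → f (array U i)) L + count f O
  below-ordinary f = trans (cong (below (λ i → f (array U i))) (cong suc R≡))
    (trans (below-window f U nLeft nOrd left+ord≤n)
           (cong (λ z → below (λ i → f (array U i)) z + count f O) (sym L≡)))

  below-ordinary-prefix : ∀ (f : ℕ → Bool) j → j ≤ nOrd →
    below (λ i → f (array U i)) (L + j) ≡ below (λ i → f (array U i)) L + count f (take j O)
  below-ordinary-prefix f j j≤N = begin
      below (λ i → f (array U i)) (L + j)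
    ≡⟨ cong (λ z → below (λ i → f (array U i)) (z + j)) L≡ ⟩
      below (λ i → f (array U i)) (suc nLeft + j)
    ≡⟨ below-window f U nLeft j (≤-trans (+-monoʳ-≤ nLeft j≤N) left+ord≤n) ⟩
      below (λ i → f (array U i)) (suc nLeft) + count f (take j (drop nLeft U))
    ≡⟨ cong₂ _+_ (cong (below (λ i → f (array U i))) (sym L≡)) (cong (count f) (sym take-prefix)) ⟩
      below (λ i → f (array U i)) L + count f (take j O)
    ∎
    where
    open ≡-Reasoning
    take-prefix : take j O ≡ take j (drop nLeft U)
    take-prefix = trans (take-take j nOrd (drop nLeft U)) (cong (λ z → take z (drop nLeft U)) (m≤n⇒m⊓n≡m j≤N))

  private
    length-sorted-sample : length (sort S) ≡ nLeft + (t3 + 1)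
    length-sorted-sample = trans (↭-length (sort-↭ S)) (trans (length-++ (take nLeft U))
      (cong₂ _+_ (trans (length-take nLeft U) (m≤n⇒m⊓n≡m (≤-trans (m≤m+n nLeft nOrd) left+ord≤n)))
                 (trans (length-drop R U) (m∸[m∸n]≡n t3+1≤n))))
      where
      t3+1≤n : t3 + 1 ≤ length U
      t3+1≤n = ≤-trans (≤-trans (m≤n+m (t3 + 1) nLeft) (≤-reflexive (regroup t1 t2 t3))) k≤n
        where
        regroup : ∀ t1 t2 t3 → t1 + t2 + 1 + (t3 + 1) ≡ t1 + t2 + t3 + 2
        regroup = solve-∀

    Q-index : t1 + t2 + 1 < length (sort S)
    Q-index = ≤-trans (s≤s (m≤m+n nLeft t3))
      (≤-reflexive (trans (sym (+-suc nLeft t3)) (trans (cong (nLeft +_) (+-comm 1 t3)) (sym length-sorted-sample))))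

    t1≤Q-index : t1 ≤ t1 + t2 + 1
    t1≤Q-index = ≤-trans (m≤m+n t1 t2) (m≤m+n (t1 + t2) 1)

  P≤Q : pivotP t1 t2 t3 U ≤ pivotQ t1 t2 t3 U
  P≤Q = nth-mono (sort S) t1 (t1 + t2 + 1) (sort-sorted S) t1≤Q-index Q-index

  P∈S : pivotP t1 t2 t3 U ∈ S
  P∈S = ∈-resp-↭ (sort-↭ S) (nth-∈ (sort S) t1 (≤-<-trans t1≤Q-index Q-index))

  Q∈S : pivotQ t1 t2 t3 U ∈ S
  Q∈S = ∈-resp-↭ (sort-↭ S) (nth-∈ (sort S) (t1 + t2 + 1) Q-index)

  ordinary∉sample : Unique U → ∀ {x} → x ∈ O → x ∉ S
  ordinary∉sample u = unique-middle (take nLeft U) O (drop R U) (subst Unique (sym decomposition) u)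
    where
    decomposition : take nLeft U ++ O ++ drop R U ≡ U
    decomposition =
      trans (cong (λ z → take nLeft U ++ (O ++ z)) (trans (cong (λ r → drop r U) R≡) (sym (drop-drop nLeft nOrd U))))
            (trans (cong (take nLeft U ++_) (take++drop≡id nOrd (drop nLeft U))) (take++drop≡id nLeft U))

  array-ordinary : ∀ i → L ≤ i → i ≤ R → array U i ∈ O
  array-ordinary i L≤i i≤R = subst (_∈ O) (trans (nth-ordinary j j<N) (cong (array U) L+j≡i))
                                   (nth-∈ O j (<-≤-trans j<N (≤-reflexive (sym length-ordinary))))
    where
    j = i ∸ L
    L+j≡i : L + j ≡ i
    L+j≡i = m+[n∸m]≡n L≤i
    j<N : j < nOrd
    j<N = +-cancelˡ-≤ nLeft (suc j) nOrd (≤-trans (≤-reflexive (trans (+-suc nLeft j) (cong (_+ j) (sym L≡))))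
            (≤-trans (≤-reflexive L+j≡i) (≤-trans i≤R (≤-reflexive R≡))))

  no-Q-in-range : Unique U → ∀ i → L ≤ i → i ≤ R → array U i ≢ pivotQ t1 t2 t3 U
  no-Q-in-range u i L≤i i≤R eq = ordinary∉sample u (array-ordinary i L≤i i≤R) (subst (_∈ S) (sym eq) Q∈S)

-- The colour sequence of the ordinary elements (true = large).
colours : ℕ → ℕ → ℕ → List ℕ → List Bool
colours t1 t2 t3 U = map (λ x → pivotQ t1 t2 t3 U <ᵇ x) (ordinary t1 t2 t3 U)

small+medium≡notLarge : ∀ x p q → x ≢ p → x ≢ q → p ≤ q →
  indicator (x <ᵇ p) + indicator ((p <ᵇ x) ∧ (x <ᵇ q)) ≡ indicator (not (q <ᵇ x))
small+medium≡notLarge x p q x≢p x≢q p≤q with <-cmp x p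
... | tri≈ _ x≡p _ = ⊥-elim (x≢p x≡p)
... | tri< x<p _ _
  rewrite <⇒<ᵇ-true x<p | ≥⇒<ᵇ-false {p} {x} (<⇒≤ x<p) | ≥⇒<ᵇ-false {q} {x} (≤-trans (<⇒≤ x<p) p≤q) = refl
... | tri> _ _ p<x with <-cmp x q
...   | tri≈ _ x≡q _ = ⊥-elim (x≢q x≡q)
...   | tri< x<q _ _
  rewrite ≥⇒<ᵇ-false {x} {p} (<⇒≤ p<x) | <⇒<ᵇ-true p<x | <⇒<ᵇ-true x<q | ≥⇒<ᵇ-false {q} {x} (<⇒≤ x<q) = refl
...   | tri> _ _ q<x
  rewrite ≥⇒<ᵇ-false {x} {p} (<⇒≤ p<x) | <⇒<ᵇ-true p<x | ≥⇒<ᵇ-false {x} {q} (<⇒≤ q<x) | <⇒<ᵇ-true q<x = refl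

module FirstStep (t1 t2 t3 : ℕ) (U : List ℕ) (k≤n : kOf t1 t2 t3 ≤ length U) (u : Unique U) where
  open Layout t1 t2 t3 U k≤n

  P Q : ℕ
  P = pivotP t1 t2 t3 U
  Q = pivotQ t1 t2 t3 U

  open Yaroslavskiy (array U) P Q L R 1≤L P≤Q (no-Q-in-range u)

  c : List Bool
  c = colours t1 t2 t3 U

  m : ℕ
  m = count (λ x → not (Q <ᵇ x)) O

  m≤nOrd : m ≤ nOrd
  m≤nOrd = ≤-trans (count≤length _ O) (≤-reflexive length-ordinary)

  m<nOrd⇒L+m≤R : m < nOrd → L + m ≤ R
  m<nOrd⇒L+m≤R m<N = ≤-trans (≤-reflexive (trans (cong (_+ m) L≡) (sym (+-suc nLeft m))))
                             (≤-trans (+-monoʳ-≤ nLeft m<N) (≤-reflexive (sym R≡)))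

  L+m≤R⇒m<nOrd : L + m ≤ R → m < nOrd
  L+m≤R⇒m<nOrd L+m≤R = +-cancelˡ-≤ nLeft (suc m) nOrd
    (≤-trans (≤-reflexive (trans (+-suc nLeft m) (cong (_+ m) (sym L≡)))) (≤-trans L+m≤R (≤-reflexive R≡)))

  run : State
  run = partitionRun t1 t2 t3 U

  result : Outcome (State.swaps run) (State.k run) (count large (State.visited run)) m
  result = run-outcome (suc (length U)) m L≤R+1 R<L+fuel (sym (below-ordinary (λ x → not (Q <ᵇ x))))
    where
    R<L+fuel : R < L + suc (length U)
    R<L+fuel = <-≤-trans (s≤s (m∸n≤m (length U) (t3 + 1))) (m≤n+m (suc (length U)) L)

  large𝒦≡visited : large𝒦 t1 t2 t3 U ≡ count large (State.visited run)
  large𝒦≡visited = count-↭ large (↭-reverse (State.visited run))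

  TS≡I₁+large𝒦 : TS t1 t2 t3 U ≡ I₁ t1 t2 t3 U + large𝒦 t1 t2 t3 U
  TS≡I₁+large𝒦 = trans
    (+-cancelʳ-≡ (nSmall L) (State.swaps run) (I₁ t1 t2 t3 U + count large (State.visited run))
      (trans (Outcome.swaps result)
        (trans (cong (count large (State.visited run) +_) (below-ordinary (λ x → x <ᵇ P)))
               (regroup (count large (State.visited run)) (nSmall L) (I₁ t1 t2 t3 U)))))
    (cong (I₁ t1 t2 t3 U +_) (sym large𝒦≡visited))
    where
    regroup : ∀ v s i → v + (s + i) ≡ i + v + s
    regroup = solve-∀

  I₁+I₂≡m : I₁ t1 t2 t3 U + I₂ t1 t2 t3 U ≡ m
  I₁+I₂≡m = count-disjoint-union _ _ _ O (All.tabulate (λ {x} x∈O → small+medium≡notLarge x P Q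
    (λ x≡P → ordinary∉sample u x∈O (subst (_∈ S) (sym x≡P) P∈S))
    (λ x≡Q → ordinary∉sample u x∈O (subst (_∈ S) (sym x≡Q) Q∈S)) P≤Q))

  reds-prefix : nLarge (L + m) ≡ nLarge L + reds (take m c)
  reds-prefix = trans (below-ordinary-prefix (Q <ᵇ_) m m≤nOrd)
    (cong (nLarge L +_) (sym (trans (cong reds (take-map m O)) (count-map (λ b → b) (Q <ᵇ_) (take m O)))))

  -- The Bernoulli bit: the colour of ordinary position m + 1, if any.
  next-colour : m < nOrd → reds (take 1 (drop m c)) ≡ indicator (large (L + m))
  next-colour m<N =
    trans (cong (λ z → reds (take 1 z)) (drop-map m O))
      (trans (cong (λ z → reds (take 1 (map (Q <ᵇ_) z))) (drop-nth O m (<-≤-trans m<N (≤-reflexive (sym length-ordinary)))))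
        (trans (reds-singleton (Q <ᵇ nth O m)) (cong (λ z → indicator (Q <ᵇ z)) (nth-ordinary m m<N))))
    where
    reds-singleton : ∀ b → reds (b ∷ []) ≡ indicator b
    reds-singleton true  = refl
    reds-singleton false = refl

  no-next-colour : nOrd ≤ m → reds (take 1 (drop m c)) ≡ 0
  no-next-colour N≤m = cong (λ z → reds (take 1 z))
    (trans (drop-map m O) (cong (map (Q <ᵇ_)) (drop-all m O (≤-trans (≤-reflexive length-ordinary) N≤m))))

  -- k stops at L + m exactly when the Bernoulli bit is 0, so the large
  -- entries visited by k are the hypergeometric part plus that bit.
  visited≡hypGplusB : count large (State.visited run) ≡ hypGplusB m c
  visited≡hypGplusB with Outcome.final-k result
  ... | inj₁ (k≡L+m , next-not-large) =
    trans (+-cancelʳ-≡ (nLarge L) _ _ (trans (Outcome.visited result)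
            (trans (cong nLarge k≡L+m) (trans reds-prefix (+-comm (nLarge L) _)))))
          (sym (trans (cong (reds (take m c) +_) bit≡0) (+-identityʳ _)))
    where
    bit≡0 : reds (take 1 (drop m c)) ≡ 0
    bit≡0 with m <? nOrd
    ... | yes m<N = trans (next-colour m<N) (cong indicator (next-not-large (m<nOrd⇒L+m≤R m<N)))
    ... | no m≮N  = no-next-colour (≮⇒≥ m≮N)
  ... | inj₂ (k≡L+m+1 , next-large , L+m≤R) =
    trans (+-cancelʳ-≡ (nLarge L) _ (suc (reds (take m c))) (trans (Outcome.visited result)
            (trans (cong nLarge k≡L+m+1) (trans (below-true large (L + m) next-large)
                   (cong suc (trans reds-prefix (+-comm (nLarge L) _)))))))
          (sym (trans (cong (reds (take m c) +_) bit≡1) (+-comm _ 1)))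
    where
    bit≡1 : reds (take 1 (drop m c)) ≡ 1
    bit≡1 = trans (next-colour (L+m≤R⇒m<nOrd L+m≤R)) (cong indicator next-large)

  TS≡I₁+hypGplusB : TS t1 t2 t3 U ≡ I₁ t1 t2 t3 U + hypGplusB (I₁ t1 t2 t3 U + I₂ t1 t2 t3 U) c
  TS≡I₁+hypGplusB = trans TS≡I₁+large𝒦 (cong (I₁ t1 t2 t3 U +_)
    (trans large𝒦≡visited (trans visited≡hypGplusB (cong (λ z → hypGplusB z c) (sym I₁+I₂≡m)))))

  I₃≡reds : I₃ t1 t2 t3 U ≡ reds c
  I₃≡reds = sym (count-map (λ b → b) (Q <ᵇ_) O)

  length-colours : length c ≡ nOrd
  length-colours = trans (length-map (Q <ᵇ_) O) length-ordinary

Unique-resp-↭ : {A : Set} {xs ys : List A} → xs ↭ ys → Unique xs → Unique ys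
Unique-resp-↭ {A} p = ↭ₛ.Unique-resp-↭ (setoid A) (↭⇒↭ₛ p)

∈-concatMap-∃ : ∀ {A B : Set} {z : B} (f : A → List B) xs → z ∈ concatMap f xs → ∃ λ y → y ∈ xs × z ∈ f y
∈-concatMap-∃ f xs z∈ = find (∈-concatMap⁻ f z∈)

unique-concatMap : ∀ {A B : Set} (f : A → List B) xs → (∀ {y} → y ∈ xs → Unique (f y)) →
  (∀ {y y′ z} → y ∈ xs → y′ ∈ xs → z ∈ f y → z ∈ f y′ → y ≡ y′) → Unique xs → Unique (concatMap f xs)
unique-concatMap f []       _      _        _          = []
unique-concatMap f (y ∷ ys) unique disjoint (y∉ys ∷ u) =
  Unique.++⁺ (unique (here refl))
    (unique-concatMap f ys (λ i → unique (there i)) (λ i i′ → disjoint (there i) (there i′)) u)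
    (λ (z∈fy , z∈rest) → let (y′ , y′∈ys , z∈fy′) = ∈-concatMap-∃ f ys z∈rest in
       All.lookup y∉ys y′∈ys (disjoint (here refl) (there y′∈ys) z∈fy z∈fy′))

insertAll-↭ : ∀ {A : Set} (x : A) ys {z} → z ∈ insertAll x ys → z ↭ x ∷ ys
insertAll-↭ x []       (here refl) = ↭-refl
insertAll-↭ x (y ∷ ys) (here refl) = ↭-refl
insertAll-↭ x (y ∷ ys) (there z∈) with ∈-map⁻ (y ∷_) z∈
... | z′ , z′∈ , refl = ↭-trans (↭-prep y (insertAll-↭ x ys z′∈)) (↭.swap y x ↭-refl)

insertAll-∈ : ∀ {A : Set} (x : A) as bs → as ++ x ∷ bs ∈ insertAll x (as ++ bs)
insertAll-∈ x []       []       = here refl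
insertAll-∈ x []       (b ∷ bs) = here refl
insertAll-∈ x (a ∷ as) bs       = there (∈-map⁺ (a ∷_) (insertAll-∈ x as bs))

-- Deleting the first occurrence of x undoes any insertion of a fresh x.
delete : ℕ → List ℕ → List ℕ
delete x [] = []
delete x (y ∷ r) with x ≟ y
... | yes _ = r
... | no  _ = y ∷ delete x r

delete-insertAll : ∀ (x : ℕ) ys {z} → x ∉ ys → z ∈ insertAll x ys → delete x z ≡ ys
delete-insertAll x []       x∉ys (here refl) with x ≟ x
... | yes _   = refl
... | no x≢x = ⊥-elim (x≢x refl)
delete-insertAll x (y ∷ ys) x∉ys (here refl) with x ≟ x
... | yes _   = refl
... | no x≢x = ⊥-elim (x≢x refl)
delete-insertAll x (y ∷ ys) x∉ys (there z∈) with ∈-map⁻ (y ∷_) z∈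
... | z′ , z′∈ , refl with x ≟ y
...   | yes x≡y = ⊥-elim (x∉ys (here x≡y))
...   | no  _   = cong (y ∷_) (delete-insertAll x ys (λ i → x∉ys (there i)) z′∈)

unique-insertAll : ∀ {A : Set} (x : A) ys → x ∉ ys → Unique (insertAll x ys)
unique-insertAll x []       x∉ys = [] ∷ []
unique-insertAll x (y ∷ ys) x∉ys =
  All.tabulate (λ w∈ eq → let (_ , _ , e) = ∈-map⁻ (y ∷_) w∈ in x∉ys (here (cong (head-or x) (trans eq e))))
  ∷ Unique.map⁺ (λ { refl → refl }) (unique-insertAll x ys (λ i → x∉ys (there i)))
  where
  head-or : ∀ {A : Set} → A → List A → A
  head-or d []      = d
  head-or d (a ∷ _) = a

perms-↭ : ∀ {A : Set} (l : List A) {z} → z ∈ perms l → z ↭ l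
perms-↭ []       (here refl) = ↭-refl
perms-↭ (x ∷ xs) z∈ with ∈-concatMap-∃ (insertAll x) (perms xs) z∈
... | ys , ys∈ , z∈′ = ↭-trans (insertAll-↭ x ys z∈′) (↭-prep x (perms-↭ xs ys∈))

↭-[] : ∀ {A : Set} {z : List A} → z ↭ [] → z ≡ []
↭-[] {z = []}    _ = refl
↭-[] {z = a ∷ z} p with ∈-resp-↭ p (here refl)
... | ()

perms-complete : ∀ {A : Set} (l : List A) {z} → z ↭ l → z ∈ perms l
perms-complete []       p with ↭-[] p
... | refl = here refl
perms-complete (x ∷ xs) p with ∈-∃++ (∈-resp-↭ (↭-sym p) (here refl))
... | as , bs , refl = ∈-concatMap⁺ (insertAll x)
        (lose (perms-complete xs (drop-∷ (↭-trans (↭-sym (shift x as bs)) p))) (insertAll-∈ x as bs))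

perms-unique : ∀ (l : List ℕ) → Unique l → Unique (perms l)
perms-unique []       _          = [] ∷ []
perms-unique (x ∷ xs) (x∉xs ∷ u) =
  unique-concatMap (insertAll x) (perms xs)
    (λ {ys} ys∈ → unique-insertAll x ys (fresh ys∈))
    (λ {y} {y′} y∈ y′∈ z∈ z∈′ → trans (sym (delete-insertAll x y (fresh y∈) z∈)) (delete-insertAll x y′ (fresh y′∈) z∈′))
    (perms-unique xs u)
  where
  fresh : ∀ {ys} → ys ∈ perms xs → x ∉ ys
  fresh ys∈ x∈ = All.lookup x∉xs (∈-resp-↭ (perms-↭ xs ys∈) x∈) refl

∈-delete-middle : ∀ {A : Set} {z x : A} as {bs} → z ∈ as ++ x ∷ bs → z ≢ x → z ∈ as ++ bs
∈-delete-middle []       (here z≡x) z≢x = ⊥-elim (z≢x z≡x)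
∈-delete-middle []       (there z∈) _   = z∈
∈-delete-middle (a ∷ as) (here z≡a) _   = here z≡a
∈-delete-middle (a ∷ as) (there z∈) z≢x = there (∈-delete-middle as z∈ z≢x)

∈-insert-middle : ∀ {A : Set} {z x : A} as {bs} → z ∈ as ++ bs → z ∈ as ++ x ∷ bs
∈-insert-middle []       z∈         = there z∈
∈-insert-middle (a ∷ as) (here z≡a) = here z≡a
∈-insert-middle (a ∷ as) (there z∈) = there (∈-insert-middle as z∈)

unique-delete-middle : ∀ {A : Set} {x : A} as {bs} → Unique (as ++ x ∷ bs) → Unique (as ++ bs)
unique-delete-middle []       (_ ∷ u)     = u
unique-delete-middle (a ∷ as) (a∉ ∷ u) = All.tabulate (λ z∈ → All.lookup a∉ (∈-insert-middle as z∈)) ∷ unique-delete-middle as u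

unique-middle-fresh : ∀ {A : Set} {x : A} as {bs} → Unique (as ++ x ∷ bs) → x ∉ as ++ bs
unique-middle-fresh []       (x∉ ∷ _) x∈        = All.lookup x∉ x∈ refl
unique-middle-fresh (a ∷ as) (a∉ ∷ u) (here x≡a) = All.lookup a∉ (∈-++⁺ʳ as (here refl)) (sym x≡a)
unique-middle-fresh (a ∷ as) (a∉ ∷ u) (there x∈) = unique-middle-fresh as u x∈

unique-same-members-↭ : ∀ {A : Set} {xs ys : List A} → Unique xs → Unique ys →
  (∀ {z} → z ∈ xs → z ∈ ys) → (∀ {z} → z ∈ ys → z ∈ xs) → xs ↭ ys
unique-same-members-↭ {xs = []} {[]}     _ _ _ _ = ↭-refl
unique-same-members-↭ {xs = []} {y ∷ ys} _ _ _ ys⊆xs with ys⊆xs (here refl)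
... | ()
unique-same-members-↭ {xs = x ∷ xs} (x∉xs ∷ uxs) uys xs⊆ys ys⊆xs with ∈-∃++ (xs⊆ys (here refl))
... | as , bs , refl =
  ↭-trans (↭-prep x (unique-same-members-↭ uxs (unique-delete-middle as uys)
             (λ z∈xs → ∈-delete-middle as (xs⊆ys (there z∈xs)) (λ z≡x → All.lookup x∉xs z∈xs (sym z≡x)))
             (λ z∈ → other-than-x z∈ (ys⊆xs (∈-insert-middle as z∈)))))
          (↭-sym (shift x as bs))
  where
  other-than-x : ∀ {z} → z ∈ as ++ bs → z ∈ x ∷ xs → z ∈ xs
  other-than-x z∈ (here z≡x) = ⊥-elim (unique-middle-fresh as uys (subst (_∈ as ++ bs) z≡x z∈))
  other-than-x z∈ (there z∈xs) = z∈xs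

count-perms-involution : ∀ (τ : List ℕ → List ℕ) → (∀ z → τ (τ z) ≡ z) → (∀ z → τ z ↭ z) →
  ∀ l → Unique l → ∀ (f : List ℕ → Bool) → count f (perms l) ≡ count (λ z → f (τ z)) (perms l)
count-perms-involution τ involutive rearranges l u f =
  trans (count-↭ f (↭-sym τ-permutes)) (count-map f τ (perms l))
  where
  τ-injective : ∀ {a b} → τ a ≡ τ b → a ≡ b
  τ-injective {a} {b} e = trans (sym (involutive a)) (trans (cong τ e) (involutive b))
  τ-permutes : map τ (perms l) ↭ perms l
  τ-permutes = unique-same-members-↭ (Unique.map⁺ τ-injective (perms-unique l u)) (perms-unique l u)
    (λ z∈ → let (w , w∈ , z≡τw) = ∈-map⁻ τ z∈ in
       perms-complete l (↭-trans (subst (_↭ w) (sym z≡τw) (rearranges w)) (perms-↭ l w∈)))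
    (λ {z} z∈ → subst (_∈ map τ (perms l)) (involutive z)
       (∈-map⁺ τ (perms-complete l (↭-trans (rearranges z) (perms-↭ l z∈)))))

-- swapAt i exchanges the entries at (0-based) positions i and i + 1.
swapAt : ∀ {A : Set} → ℕ → List A → List A
swapAt zero    (x ∷ y ∷ r) = y ∷ x ∷ r
swapAt (suc i) (x ∷ r)     = x ∷ swapAt i r
swapAt _       xs          = xs

swapAt-involutive : ∀ {A : Set} i (xs : List A) → swapAt i (swapAt i xs) ≡ xs
swapAt-involutive zero    []          = refl
swapAt-involutive zero    (x ∷ [])    = refl
swapAt-involutive zero    (x ∷ y ∷ r) = refl
swapAt-involutive (suc i) []          = refl
swapAt-involutive (suc i) (x ∷ r)     = cong (x ∷_) (swapAt-involutive i r)

swapAt-↭ : ∀ {A : Set} i (xs : List A) → swapAt i xs ↭ xs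
swapAt-↭ zero    []          = ↭-refl
swapAt-↭ zero    (x ∷ [])    = ↭-refl
swapAt-↭ zero    (x ∷ y ∷ r) = ↭.swap y x ↭-refl
swapAt-↭ (suc i) []          = ↭-refl
swapAt-↭ (suc i) (x ∷ r)     = ↭-prep x (swapAt-↭ i r)

map-swapAt : ∀ {A B : Set} (f : A → B) i xs → map f (swapAt i xs) ≡ swapAt i (map f xs)
map-swapAt f zero    []          = refl
map-swapAt f zero    (x ∷ [])    = refl
map-swapAt f zero    (x ∷ y ∷ r) = refl
map-swapAt f (suc i) []          = refl
map-swapAt f (suc i) (x ∷ r)     = cong (f x ∷_) (map-swapAt f i r)

take-swapAt-beyond : ∀ {A : Set} a j (xs : List A) → take a (swapAt (a + j) xs) ≡ take a xs
take-swapAt-beyond zero    j xs      = refl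
take-swapAt-beyond (suc a) j []      = refl
take-swapAt-beyond (suc a) j (x ∷ r) = cong (x ∷_) (take-swapAt-beyond a j r)

drop-swapAt-beyond : ∀ {A : Set} a j (xs : List A) → drop a (swapAt (a + j) xs) ≡ swapAt j (drop a xs)
drop-swapAt-beyond zero    j       xs      = refl
drop-swapAt-beyond (suc a) zero    []      = refl
drop-swapAt-beyond (suc a) (suc j) []      = refl
drop-swapAt-beyond (suc a) j       (x ∷ r) = drop-swapAt-beyond a j r

take-swapAt-inside : ∀ {A : Set} j N (xs : List A) → suc (suc j) ≤ N → take N (swapAt j xs) ≡ swapAt j (take N xs)
take-swapAt-inside zero    (suc (suc N)) []          _ = refl
take-swapAt-inside zero    (suc (suc N)) (x ∷ [])    _ = refl
take-swapAt-inside zero    (suc (suc N)) (x ∷ y ∷ r) _ = refl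
take-swapAt-inside zero    (suc zero)    _           (s≤s ())
take-swapAt-inside (suc j) (suc N)       []          _ = refl
take-swapAt-inside (suc j) (suc N)       (x ∷ r) (s≤s j+2≤N) = cong (x ∷_) (take-swapAt-inside j N r j+2≤N)

drop-swapAt-inside : ∀ {A : Set} i d (xs : List A) → suc (suc i) ≤ d → drop d (swapAt i xs) ≡ drop d xs
drop-swapAt-inside zero    (suc (suc d)) []          _ = refl
drop-swapAt-inside zero    (suc (suc d)) (x ∷ [])    _ = refl
drop-swapAt-inside zero    (suc (suc d)) (x ∷ y ∷ r) _ = refl
drop-swapAt-inside zero    (suc zero)    _           (s≤s ())
drop-swapAt-inside (suc i) (suc d)       []          _ = refl
drop-swapAt-inside (suc i) (suc d)       (x ∷ r) (s≤s i+2≤d) = drop-swapAt-inside i d r i+2≤d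

swapAt-middle : ∀ {A : Set} (pre : List A) x y c → swapAt (length pre) (pre ++ x ∷ y ∷ c) ≡ pre ++ y ∷ x ∷ c
swapAt-middle []        x y c = refl
swapAt-middle (a ∷ pre) x y c = cong (a ∷_) (swapAt-middle pre x y c)

canonical : ℕ → ℕ → List Bool
canonical r s = replicate r true ++ replicate s false

canonical-↭ : ∀ (c : List Bool) → c ↭ canonical (reds c) (count not c)
canonical-↭ []          = ↭-refl
canonical-↭ (true ∷ c)  = ↭-prep true (canonical-↭ c)
canonical-↭ (false ∷ c) = ↭-trans (↭-prep false (canonical-↭ c)) (↭-sym (shift false (replicate (reds c) true) _))

reds+blues : ∀ (c : List Bool) → reds c + count not c ≡ length c
reds+blues []          = refl
reds+blues (true ∷ c)  = cong suc (reds+blues c)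
reds+blues (false ∷ c) = trans (+-suc _ _) (cong suc (reds+blues c))

_==_ : List Bool → List Bool → Bool
[]          == []          = true
(true ∷ c)  == (true ∷ d)  = c == d
(false ∷ c) == (false ∷ d) = c == d
_           == _           = false

==-refl : ∀ c → (c == c) ≡ true
==-refl []          = refl
==-refl (true ∷ c)  = ==-refl c
==-refl (false ∷ c) = ==-refl c

==⇒≡ : ∀ c d → (c == d) ≡ true → c ≡ d
==⇒≡ []          []          _ = refl
==⇒≡ (true ∷ c)  (true ∷ d)  e = cong (true ∷_) (==⇒≡ c d e)
==⇒≡ (false ∷ c) (false ∷ d) e = cong (false ∷_) (==⇒≡ c d e)
==⇒≡ []          (_ ∷ _)     ()
==⇒≡ (true ∷ c)  []          ()
==⇒≡ (false ∷ c) []          ()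
==⇒≡ (true ∷ c)  (false ∷ d) ()
==⇒≡ (false ∷ c) (true ∷ d)  ()

Bool-ext : ∀ {b₁ b₂ : Bool} → (b₁ ≡ true → b₂ ≡ true) → (b₂ ≡ true → b₁ ≡ true) → b₁ ≡ b₂
Bool-ext {true}  {true}  _ _ = refl
Bool-ext {true}  {false} f _ = sym (f refl)
Bool-ext {false} {true}  _ g = g refl
Bool-ext {false} {false} _ _ = refl

==-swapAt : ∀ j v c → (swapAt j v == c) ≡ (v == swapAt j c)
==-swapAt j v c = Bool-ext
  (λ e → subst (λ z → (v == z) ≡ true) (trans (sym (swapAt-involutive j v)) (cong (swapAt j) (==⇒≡ (swapAt j v) c e))) (==-refl v))
  (λ e → subst (λ z → (swapAt j v == z) ≡ true) (trans (cong (swapAt j) (==⇒≡ v (swapAt j c) e)) (swapAt-involutive j c)) (==-refl (swapAt j v)))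

sumOver : ∀ {A : Set} → (A → ℕ) → List A → ℕ
sumOver f []       = 0
sumOver f (x ∷ xs) = f x + sumOver f xs

sumOver-cong : ∀ {A : Set} (f g : A → ℕ) xs → (∀ {x} → x ∈ xs → f x ≡ g x) → sumOver f xs ≡ sumOver g xs
sumOver-cong f g []       h = refl
sumOver-cong f g (x ∷ xs) h = cong₂ _+_ (h (here refl)) (sumOver-cong f g xs (λ i → h (there i)))

sumOver-+ : ∀ {A : Set} (f g : A → ℕ) xs → sumOver (λ x → f x + g x) xs ≡ sumOver f xs + sumOver g xs
sumOver-+ f g []       = refl
sumOver-+ f g (x ∷ xs) =
  trans (cong (f x + g x +_) (sumOver-+ f g xs)) (+-interchange (f x) (g x) (sumOver f xs) (sumOver g xs))

sumOver-*ʳ : ∀ {A : Set} (f : A → ℕ) K xs → sumOver (λ x → f x * K) xs ≡ sumOver f xs * K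
sumOver-*ʳ f K []       = refl
sumOver-*ʳ f K (x ∷ xs) = trans (cong (f x * K +_) (sumOver-*ʳ f K xs)) (sym (*-distribʳ-+ K (f x) (sumOver f xs)))

sumOver-indicator : ∀ {A : Set} (f : A → Bool) xs → sumOver (λ x → indicator (f x)) xs ≡ count f xs
sumOver-indicator f []       = refl
sumOver-indicator f (x ∷ xs) = trans (cong (indicator (f x) +_) (sumOver-indicator f xs)) (sym (count-cons f x xs))

sumOver-zero : ∀ {A : Set} (xs : List A) → sumOver (λ _ → 0) xs ≡ 0
sumOver-zero []       = refl
sumOver-zero (x ∷ xs) = sumOver-zero xs

count-by-classes : ∀ {A B : Set} (P : A → Bool) (e : A → B → Bool) (Bs : List B) xs →
  (∀ {U} → U ∈ xs → count (e U) Bs ≡ 1) →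
  sumOver (λ c → count (λ U → P U ∧ e U c) xs) Bs ≡ count P xs
count-by-classes P e Bs []       _   = sumOver-zero Bs
count-by-classes P e Bs (U ∷ xs) one =
  begin
    sumOver (λ c → count (λ U′ → P U′ ∧ e U′ c) (U ∷ xs)) Bs
  ≡⟨ sumOver-cong _ _ Bs (λ {c} _ → count-cons (λ U′ → P U′ ∧ e U′ c) U xs) ⟩
    sumOver (λ c → indicator (P U ∧ e U c) + count (λ U′ → P U′ ∧ e U′ c) xs) Bs
  ≡⟨ sumOver-+ (λ c → indicator (P U ∧ e U c)) _ Bs ⟩
    sumOver (λ c → indicator (P U ∧ e U c)) Bs + sumOver (λ c → count (λ U′ → P U′ ∧ e U′ c) xs) Bs
  ≡⟨ cong₂ _+_ (trans (sumOver-indicator (λ c → P U ∧ e U c) Bs) own-class)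
               (count-by-classes P e Bs xs (λ i → one (there i))) ⟩
    indicator (P U) + count P xs
  ≡⟨ sym (count-cons P U xs) ⟩
    count P (U ∷ xs)
  ∎
  where
  open ≡-Reasoning
  own-class : count (λ c → P U ∧ e U c) Bs ≡ indicator (P U)
  own-class with P U
  ... | true  = one (here refl)
  ... | false = count-none Bs

bools-length : ∀ N {c} → c ∈ bools N → length c ≡ N
bools-length zero    (here refl) = refl
bools-length (suc N) {c} c∈ with ∈-++⁻ (map (true ∷_) (bools N)) c∈
... | inj₁ c∈′ = let (c′ , c′∈ , c≡) = ∈-map⁻ (true ∷_) c∈′ in trans (cong length c≡) (cong suc (bools-length N c′∈))
... | inj₂ c∈′ = let (c′ , c′∈ , c≡) = ∈-map⁻ (false ∷_) c∈′ in trans (cong length c≡) (cong suc (bools-length N c′∈))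

bools-once : ∀ N v → length v ≡ N → count (v ==_) (bools N) ≡ 1
bools-once zero    []      _   = refl
bools-once (suc N) (b ∷ v) len =
  trans (count-++ ((b ∷ v) ==_) (map (true ∷_) (bools N)) _)
    (trans (cong₂ _+_ (count-map ((b ∷ v) ==_) (true ∷_) (bools N)) (count-map ((b ∷ v) ==_) (false ∷_) (bools N)))
           (by-head b))
  where
  ih = bools-once N v (suc-injective len)
  by-head : ∀ b → count (λ c → (b ∷ v) == (true ∷ c)) (bools N) + count (λ c → (b ∷ v) == (false ∷ c)) (bools N) ≡ 1
  by-head true  = cong₂ _+_ ih (count-none (bools N))
  by-head false = cong₂ _+_ (count-none (bools N)) ih

hasI-true : ∀ t1 t2 t3 i1 i2 i3 U → hasI t1 t2 t3 i1 i2 i3 U ≡ true →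
  I₁ t1 t2 t3 U ≡ i1 × I₂ t1 t2 t3 U ≡ i2 × I₃ t1 t2 t3 U ≡ i3
hasI-true t1 t2 t3 i1 i2 i3 U e
  with I₁ t1 t2 t3 U ≡ᵇ i1 in e₁ | I₂ t1 t2 t3 U ≡ᵇ i2 in e₂ | I₃ t1 t2 t3 U ≡ᵇ i3 in e₃
... | true  | true  | true  = ≡ᵇ-true⇒≡ e₁ , ≡ᵇ-true⇒≡ e₂ , ≡ᵇ-true⇒≡ e₃
... | false | _     | _     = ⊥-elim (true≢false (sym e))
... | true  | false | _     = ⊥-elim (true≢false (sym e))
... | true  | true  | false = ⊥-elim (true≢false (sym e))

-- Exchangeability.  Among the inputs U ∈ perms (upTo n) with I(U) = (i1, i2, i3),
-- the number whose colour sequence is c depends only on the number of reds of c.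
module Exchangeability (t1 t2 t3 n : ℕ) (k≤n : kOf t1 t2 t3 ≤ n) (i1 i2 i3 : ℕ) where

  inputs : List (List ℕ)
  inputs = perms (upTo n)

  nOrd nLeft : ℕ
  nOrd  = n ∸ kOf t1 t2 t3
  nLeft = t1 + t2 + 1

  hasI′ : List ℕ → Bool
  hasI′ = hasI t1 t2 t3 i1 i2 i3

  input-length : ∀ {U} → U ∈ inputs → length U ≡ n
  input-length U∈ = trans (↭-length (perms-↭ (upTo n) U∈)) (length-upTo n)

  input-unique : ∀ {U} → U ∈ inputs → Unique U
  input-unique U∈ = Unique-resp-↭ (↭-sym (perms-↭ _ U∈)) (Unique.upTo⁺ n)

  k≤length : ∀ (U : List ℕ) → length U ≡ n → kOf t1 t2 t3 ≤ length U
  k≤length U len = ≤-trans k≤n (≤-reflexive (sym len))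

  -- Exchanging the ordinary elements j and j + 1 of U leaves the sample,
  -- hence the pivots and I, unchanged and transposes the colour sequence.
  module AdjacentExchange (U : List ℕ) (len : length U ≡ n) (j : ℕ) (j+2≤N : suc (suc j) ≤ nOrd) where
    open Layout t1 t2 t3 U (k≤length U len) using (R≡)

    U′ : List ℕ
    U′ = swapAt (nLeft + j) U

    j+2≤N′ : suc (suc j) ≤ length U ∸ kOf t1 t2 t3
    j+2≤N′ = ≤-trans j+2≤N (≤-reflexive (cong (_∸ kOf t1 t2 t3) (sym len)))

    length-U′ : length U′ ≡ length U
    length-U′ = ↭-length (swapAt-↭ (nLeft + j) U)

    same-sample : sample t1 t2 t3 U′ ≡ sample t1 t2 t3 U
    same-sample = cong₂ _++_ (take-swapAt-beyond nLeft j U)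
      (trans (cong (λ l → drop (l ∸ (t3 + 1)) U′) length-U′)
             (drop-swapAt-inside (nLeft + j) (length U ∸ (t3 + 1)) U right-of-swap))
      where
      right-of-swap : suc (suc (nLeft + j)) ≤ length U ∸ (t3 + 1)
      right-of-swap = ≤-trans (≤-reflexive (trans (cong suc (sym (+-suc nLeft j))) (sym (+-suc nLeft (suc j)))))
                              (≤-trans (+-monoʳ-≤ nLeft j+2≤N′) (≤-reflexive (sym R≡)))

    ordinary-swapped : ordinary t1 t2 t3 U′ ≡ swapAt j (ordinary t1 t2 t3 U)
    ordinary-swapped = trans (cong (λ l → take (l ∸ kOf t1 t2 t3) (drop nLeft U′)) length-U′)
      (trans (cong (take (length U ∸ kOf t1 t2 t3)) (drop-swapAt-beyond nLeft j U))
             (take-swapAt-inside j (length U ∸ kOf t1 t2 t3) (drop nLeft U) j+2≤N′))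

    same-P : pivotP t1 t2 t3 U′ ≡ pivotP t1 t2 t3 U
    same-P = cong (λ s → nth (sort s) t1) same-sample

    same-Q : pivotQ t1 t2 t3 U′ ≡ pivotQ t1 t2 t3 U
    same-Q = cong (λ s → nth (sort s) (t1 + t2 + 1)) same-sample

    O↭ : ordinary t1 t2 t3 U′ ↭ ordinary t1 t2 t3 U
    O↭ = subst (_↭ ordinary t1 t2 t3 U) (sym ordinary-swapped) (swapAt-↭ j _)

    same-hasI : hasI′ U′ ≡ hasI′ U
    same-hasI = cong₂ _∧_ (cong (_≡ᵇ i1) same-I₁) (cong₂ _∧_ (cong (_≡ᵇ i2) same-I₂) (cong (_≡ᵇ i3) same-I₃))
      where
      same-I₁ : I₁ t1 t2 t3 U′ ≡ I₁ t1 t2 t3 U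
      same-I₁ = trans (cong (λ P → count (λ x → x <ᵇ P) (ordinary t1 t2 t3 U′)) same-P) (count-↭ _ O↭)
      same-I₂ : I₂ t1 t2 t3 U′ ≡ I₂ t1 t2 t3 U
      same-I₂ = trans (cong₂ (λ P Q → count (λ x → (P <ᵇ x) ∧ (x <ᵇ Q)) (ordinary t1 t2 t3 U′)) same-P same-Q)
                      (count-↭ _ O↭)
      same-I₃ : I₃ t1 t2 t3 U′ ≡ I₃ t1 t2 t3 U
      same-I₃ = trans (cong (λ Q → count (λ x → Q <ᵇ x) (ordinary t1 t2 t3 U′)) same-Q) (count-↭ _ O↭)

    colours-swapped : colours t1 t2 t3 U′ ≡ swapAt j (colours t1 t2 t3 U)
    colours-swapped = trans (cong₂ (λ Q o → map (λ x → Q <ᵇ x) o) same-Q ordinary-swapped)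
                            (map-swapAt _ j (ordinary t1 t2 t3 U))

  classSize : List Bool → ℕ
  classSize c = count (λ U → hasI′ U ∧ (colours t1 t2 t3 U == c)) inputs

  classSize-swapAt : ∀ j c → suc (suc j) ≤ nOrd → classSize c ≡ classSize (swapAt j c)
  classSize-swapAt j c j+2≤N =
    trans (count-perms-involution (swapAt (nLeft + j)) (swapAt-involutive (nLeft + j)) (swapAt-↭ (nLeft + j))
                                  (upTo n) (Unique.upTo⁺ n) _)
          (count-cong _ _ inputs (λ {U} U∈ → let open AdjacentExchange U (input-length U∈) j j+2≤N in
             cong₂ _∧_ same-hasI (trans (cong (_== c) colours-swapped) (==-swapAt j (colours t1 t2 t3 U) c))))

  classSize-↭ : ∀ pre {c c′} → c ↭ c′ → length pre + length c ≡ nOrd → classSize (pre ++ c) ≡ classSize (pre ++ c′)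
  classSize-↭ pre ↭.refl _ = refl
  classSize-↭ pre {x ∷ c} {x ∷ c′} (↭.prep x p) len =
    trans (cong classSize (sym (++-assoc pre [ x ] c)))
      (trans (classSize-↭ (pre ++ [ x ]) p (trans (cong (_+ length c) (length-++ pre)) (trans (shift-one (length pre) (length c)) len)))
             (cong classSize (++-assoc pre [ x ] c′)))
    where
    shift-one : ∀ a b → a + 1 + b ≡ a + suc b
    shift-one = solve-∀
  classSize-↭ pre {x ∷ y ∷ c} {y ∷ x ∷ c′} (↭.swap x y p) len =
    trans (classSize-swapAt (length pre) (pre ++ x ∷ y ∷ c) pre+2≤N)
      (trans (cong classSize (swapAt-middle pre x y c))
        (trans (cong classSize (sym (++-assoc pre (y ∷ x ∷ []) c)))
          (trans (classSize-↭ (pre ++ y ∷ x ∷ []) p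
                   (trans (cong (_+ length c) (length-++ pre)) (trans (shift-two (length pre) (length c)) len)))
                 (cong classSize (++-assoc pre (y ∷ x ∷ []) c′)))))
    where
    shift-two : ∀ a b → a + 2 + b ≡ a + suc (suc b)
    shift-two = solve-∀
    pre+2≤N : suc (suc (length pre)) ≤ nOrd
    pre+2≤N = ≤-trans (≤-trans (≤-reflexive (+-comm 2 (length pre))) (m≤m+n (length pre + 2) (length c)))
                      (≤-reflexive (trans (shift-two (length pre) (length c)) len))
  classSize-↭ pre (↭.trans p q) len =
    trans (classSize-↭ pre p len) (classSize-↭ pre q (trans (cong (length pre +_) (sym (↭-length p))) len))

  size₀ : ℕ
  size₀ = classSize (canonical i3 (nOrd ∸ i3))

  classSize-reds : ∀ c → length c ≡ nOrd → reds c ≡ i3 → classSize c ≡ size₀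
  classSize-reds c len r = trans (classSize-↭ [] (canonical-↭ c) len)
    (cong₂ (λ r s → classSize (canonical r s)) r
      (trans (sym (m+n∸m≡n (reds c) (count not c))) (cong₂ _∸_ (trans (reds+blues c) len) r)))

  classSize-other : ∀ c → (reds c ≡ᵇ i3) ≡ false → classSize c ≡ 0
  classSize-other c r≢i3 = trans (count-cong _ (λ _ → false) inputs excluded) (count-none inputs)
    where
    excluded : ∀ {U} → U ∈ inputs → (hasI′ U ∧ (colours t1 t2 t3 U == c)) ≡ false
    excluded {U} U∈ with hasI′ U in h | colours t1 t2 t3 U == c in e
    ... | false | _     = refl
    ... | true  | false = refl
    ... | true  | true  = ⊥-elim (true≢false (trans (sym (trans (cong (_≡ᵇ i3) reds≡i3) (≡ᵇ-refl i3))) r≢i3))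
      where
      reds≡i3 : reds c ≡ i3
      reds≡i3 = trans (cong reds (sym (==⇒≡ (colours t1 t2 t3 U) c e)))
        (trans (sym (FirstStep.I₃≡reds t1 t2 t3 U (k≤length U (input-length U∈)) (input-unique U∈)))
               (proj₂ (proj₂ (hasI-true t1 t2 t3 i1 i2 i3 U h))))

  count-by-colours : ∀ (φ : List Bool → Bool) →
    count (λ U → hasI′ U ∧ φ (colours t1 t2 t3 U)) inputs ≡ count (λ c → (reds c ≡ᵇ i3) ∧ φ c) (bools nOrd) * size₀
  count-by-colours φ =
    begin
      count (λ U → hasI′ U ∧ φ (colours t1 t2 t3 U)) inputs
    ≡⟨ sym (count-by-classes (λ U → hasI′ U ∧ φ (colours t1 t2 t3 U)) (λ U c → colours t1 t2 t3 U == c) (bools nOrd) inputs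
             (λ {U} U∈ → bools-once nOrd (colours t1 t2 t3 U)
               (trans (FirstStep.length-colours t1 t2 t3 U (k≤length U (input-length U∈)) (input-unique U∈))
                      (cong (_∸ kOf t1 t2 t3) (input-length U∈))))) ⟩
      sumOver (λ c → count (λ U → (hasI′ U ∧ φ (colours t1 t2 t3 U)) ∧ (colours t1 t2 t3 U == c)) inputs) (bools nOrd)
    ≡⟨ sumOver-cong _ (λ c → indicator ((reds c ≡ᵇ i3) ∧ φ c) * size₀) (bools nOrd) per-sequence ⟩
      sumOver (λ c → indicator ((reds c ≡ᵇ i3) ∧ φ c) * size₀) (bools nOrd)
    ≡⟨ sumOver-*ʳ _ size₀ (bools nOrd) ⟩
      sumOver (λ c → indicator ((reds c ≡ᵇ i3) ∧ φ c)) (bools nOrd) * size₀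
    ≡⟨ cong (_* size₀) (sumOver-indicator _ (bools nOrd)) ⟩
      count (λ c → (reds c ≡ᵇ i3) ∧ φ c) (bools nOrd) * size₀
    ∎
    where
    open ≡-Reasoning
    reorder : ∀ (h : Bool) v c → ((h ∧ φ v) ∧ (v == c)) ≡ ((h ∧ (v == c)) ∧ φ c)
    reorder h v c with v == c in e
    ... | false = trans (∧-zeroʳ _) (sym (cong (_∧ φ c) (∧-zeroʳ h)))
    ... | true  = trans (∧-identityʳ _) (trans (cong (λ z → h ∧ φ z) (==⇒≡ v c e)) (cong (_∧ φ c) (sym (∧-identityʳ h))))
    per-sequence : ∀ {c} → c ∈ bools nOrd →
      count (λ U → (hasI′ U ∧ φ (colours t1 t2 t3 U)) ∧ (colours t1 t2 t3 U == c)) inputs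
      ≡ indicator ((reds c ≡ᵇ i3) ∧ φ c) * size₀
    per-sequence {c} c∈ =
      trans (count-cong _ _ inputs (λ {U} _ → reorder (hasI′ U) (colours t1 t2 t3 U) c))
        (trans (count-∧-const (λ U → hasI′ U ∧ (colours t1 t2 t3 U == c)) (φ c) inputs)
               (by-cases (reds c ≡ᵇ i3) refl (φ c)))
      where
      by-cases : ∀ r → (reds c ≡ᵇ i3) ≡ r → ∀ b → (if b then classSize c else 0) ≡ indicator (r ∧ b) * size₀
      by-cases r     _ false = sym (cong (λ z → indicator z * size₀) (∧-zeroʳ r))
      by-cases true  e true  = trans (classSize-reds c (bools-length nOrd c∈) (≡ᵇ-true⇒≡ e)) (sym (+-identityʳ size₀))
      by-cases false e true  = classSize-other c e

-- Part 2 of the lemma, cross-multiplied: both sides equal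
-- #event · size₀ · #reds, by counting inputs through their colour sequences.
conditional-law : ∀ t1 t2 t3 n → kOf t1 t2 t3 ≤ n → (i1 i2 i3 j : ℕ) →
    count (λ U → hasI t1 t2 t3 i1 i2 i3 U ∧ (TS t1 t2 t3 U ≡ᵇ i1 + j)) (perms (upTo n))
    * count (λ c → reds c ≡ᵇ i3) (bools (n ∸ kOf t1 t2 t3))
    ≡ count (hasI t1 t2 t3 i1 i2 i3) (perms (upTo n))
    * count (λ c → (reds c ≡ᵇ i3) ∧ (hypGplusB (i1 + i2) c ≡ᵇ j)) (bools (n ∸ kOf t1 t2 t3))
conditional-law t1 t2 t3 n k≤n i1 i2 i3 j = begin
    count (λ U → hasI′ U ∧ (TS t1 t2 t3 U ≡ᵇ i1 + j)) inputs * #reds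
  ≡⟨ cong (_* #reds) (trans (count-cong _ _ inputs TS-via-colours) (count-by-colours event)) ⟩
    #event * size₀ * #reds
  ≡⟨ rearrange #event size₀ #reds ⟩
    #reds * size₀ * #event
  ≡⟨ cong (_* #event) (sym count-hasI) ⟩
    count hasI′ inputs * #event
  ∎
  where
  open ≡-Reasoning
  open Exchangeability t1 t2 t3 n k≤n i1 i2 i3

  event : List Bool → Bool
  event c = hypGplusB (i1 + i2) c ≡ᵇ j

  #event #reds : ℕ
  #event = count (λ c → (reds c ≡ᵇ i3) ∧ event c) (bools nOrd)
  #reds  = count (λ c → reds c ≡ᵇ i3) (bools nOrd)

  rearrange : ∀ x g y → x * g * y ≡ y * g * x
  rearrange = solve-∀

  TS-via-colours : ∀ {U} → U ∈ inputs → (hasI′ U ∧ (TS t1 t2 t3 U ≡ᵇ i1 + j)) ≡ (hasI′ U ∧ event (colours t1 t2 t3 U))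
  TS-via-colours {U} U∈ with hasI′ U in h
  ... | false = refl
  ... | true  = let (I₁≡ , I₂≡ , _) = hasI-true t1 t2 t3 i1 i2 i3 U h in
    trans (cong (_≡ᵇ i1 + j)
             (trans (FirstStep.TS≡I₁+hypGplusB t1 t2 t3 U (k≤length U (input-length U∈)) (input-unique U∈))
                    (cong₂ (λ a b → a + hypGplusB (a + b) (colours t1 t2 t3 U)) I₁≡ I₂≡)))
          (≡ᵇ-+ˡ i1 _ j)

  count-hasI : count hasI′ inputs ≡ #reds * size₀
  count-hasI = trans (count-cong _ _ inputs (λ {U} _ → sym (∧-identityʳ (hasI′ U))))
    (trans (count-by-colours (λ _ → true))
           (cong (_* size₀) (count-cong _ _ (bools nOrd) (λ {c} _ → ∧-identityʳ (reds c ≡ᵇ i3)))))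

lemma5p2 : (t1 t2 t3 w n : ℕ) → kOf t1 t2 t3 ≤ w → w < n →
    ((U : List ℕ) → length U ≡ n → Unique U →
    TS t1 t2 t3 U ≡ I₁ t1 t2 t3 U + large𝒦 t1 t2 t3 U)
    × ((i1 i2 i3 j : ℕ) →
    count (λ U → hasI t1 t2 t3 i1 i2 i3 U ∧ (TS t1 t2 t3 U ≡ᵇ i1 + j)) (perms (upTo n))
    * count (λ c → reds c ≡ᵇ i3) (bools (n ∸ kOf t1 t2 t3))
    ≡ count (hasI t1 t2 t3 i1 i2 i3) (perms (upTo n))
    * count (λ c → (reds c ≡ᵇ i3) ∧ (hypGplusB (i1 + i2) c ≡ᵇ j)) (bools (n ∸ kOf t1 t2 t3)))
lemma5p2 t1 t2 t3 w n k≤w w<n =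
  (λ U len → FirstStep.TS≡I₁+large𝒦 t1 t2 t3 U (≤-trans k≤n (≤-reflexive (sym len)))) ,
  conditional-law t1 t2 t3 n k≤n
  where
  k≤n : kOf t1 t2 t3 ≤ n
  k≤n = ≤-trans k≤w (<⇒≤ w<n)
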